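{- Let $H$ be a Kekul\'ean hexagonal system. For every integer $n\ge 0$, the map $f$ is a bijection from the set of Clar covers of $H$ with exactly $n$ hexagons onto the set of induced subgraphs of the resonance graph $R(H)$ that are isomorphic to the $n$-cube $Q_n$.
   Context: A hexagonal system is a 2-connected finite plane graph in which every interior face is a regular hexagon of side length one; its hexagons are the boundaries of its interior faces. $H$ is Kekul\'ean if it has a perfect matching. A Clar cover of $H$ is a spanning subgraph of $H$ each of whose connected components is either a hexagon of $H$ or a single edge. The resonance graph $R(H)$ has the perfect matchings of $H$ as vertices, two perfect matchings $M,M'$ being adjacent iff $M\oplus M'$ is the edge set of a hexagon of $H$. A cycle is $M$-alternating if its edges alternately belong and do not belong to $M$. For a Clar cover $C$, $f(C)$ is the subgraph of $R(H)$ induced by all perfect matchings $M$ of $H$ such that every hexagon of $C$ is $M$-alternating and every single-edge component of $C$ belongs to $M$. -}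

module Defs where

open import Data.Bool using (Bool; true; false; _xor_)
open import Data.Nat using (ℕ)
open import Data.Integer as ℤ using (ℤ; +_; _<_)
open import Data.Product using (Σ; Σ-syntax; _×_; _,_; proj₁; proj₂)
open import Data.Product.Properties using (≡-dec)
open import Data.Sum using (_⊎_)
open import Data.Unit using (⊤)
open import Data.Empty using (⊥)
open import Data.Fin using (Fin)
open import Data.List using (List; []; _∷_; length; concatMap; deduplicate)
import Data.List as List
open import Data.List.Membership.Propositional using (_∈_; _∉_)
open import Data.List.Relation.Unary.Unique.Propositional using (Unique)
open import Data.Vec using (Vec; lookup)
open import Function.Bundles using (_⇔_)
open import Relation.Nullary using (¬_)
open import Relation.Binary.PropositionalEquality using (_≡_; _≢_)
open import Relation.Binary.Definitions using (DecidableEquality)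

-- The hexagonal lattice (brick-wall model).
-- Lattice vertices are points (x , y) of ℤ²; horizontal edges join
-- (x , y) and (x+1 , y); vertical edges join (x , y) and (x , y+1)
-- whenever x + y is even.

Vertex : Set
Vertex = ℤ × ℤ

-- an edge is stored canonically as (smaller endpoint , larger endpoint):
-- horizontal edges left-to-right, vertical edges bottom-to-top.
Edge : Set
Edge = Vertex × Vertex

Cell : Set
Cell = ℤ × ℤ

_≟V_ : DecidableEquality Vertex
_≟V_ = ≡-dec ℤ._≟_ ℤ._≟_

_≟E_ : DecidableEquality Edge
_≟E_ = ≡-dec _≟V_ _≟V_

corner : Cell → Vertex
corner (i , j) = (+ 2 ℤ.* i ℤ.+ j , j)

module _ (c : Cell) where
  private
    x = proj₁ (corner c)
    y = proj₂ (corner c)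
    a = (x , y)
    b = (x ℤ.+ + 1 , y)
    cc = (x ℤ.+ + 2 , y)
    d = (x ℤ.+ + 2 , y ℤ.+ + 1)
    e = (x ℤ.+ + 1 , y ℤ.+ + 1)
    g = (x , y ℤ.+ + 1)

  cellVertices : List Vertex
  cellVertices = a ∷ b ∷ cc ∷ d ∷ e ∷ g ∷ []

  cellEdges : List Edge
  cellEdges = (a , b) ∷ (b , cc) ∷ (cc , d) ∷ (e , d) ∷ (g , e) ∷ (a , g) ∷ []

Incident : Vertex → Edge → Set
Incident v (u , w) = (u ≡ v) ⊎ (w ≡ v)

CellAdj : Cell → Cell → Set
CellAdj c d = Σ[ e ∈ Edge ] (e ∈ cellEdges c × e ∈ cellEdges d)

module _ (S : List Cell) where

  VH : List Vertex
  VH = concatMap cellVertices S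

  -- the edges of H, without repetitions (used as an index set)
  EH : List Edge
  EH = deduplicate _≟E_ (concatMap cellEdges S)

  nE : ℕ
  nE = length EH

  HAdj : Vertex → Vertex → Set
  HAdj u v = ((u , v) ∈ EH) ⊎ ((v , u) ∈ EH)

  data Walk (X : Vertex → Set) : Vertex → Vertex → Set where
    here : ∀ {v} → X v → Walk X v v
    step : ∀ {u w v} → X u → HAdj u w → Walk X w v → Walk X u v

  Connected : Set
  Connected = ∀ u v → u ∈ VH → v ∈ VH → Walk (λ _ → ⊤) u v

  ConnectedWithout : Vertex → Set
  ConnectedWithout x =
    ∀ u v → u ∈ VH → v ∈ VH → u ≢ x → v ≢ x → Walk (λ w → w ≢ x) u v

  TwoConnected : Set
  TwoConnected =
    (Σ[ u ∈ Vertex ] Σ[ v ∈ Vertex ] Σ[ w ∈ Vertex ]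
       (u ∈ VH × v ∈ VH × w ∈ VH × u ≢ v × v ≢ w × u ≢ w))
    × Connected
    × (∀ x → x ∈ VH → ConnectedWithout x)

  data CellWalk : Cell → Cell → Set where
    here : ∀ {c} → c ∉ S → CellWalk c c
    step : ∀ {c d c'} → c ∉ S → CellAdj c d → CellWalk d c' → CellWalk c c'

  -- every interior face of the plane graph H is a hexagon of S:
  -- every lattice cell not in S lies in the unbounded face, i.e. is
  -- joined by a chain of non-S cells to a cell lying strictly above
  -- all the cells of S.
  NoHoles : Set
  NoHoles = ∀ c → c ∉ S →
    Σ[ d ∈ Cell ] (CellWalk c d × (∀ h → h ∈ S → proj₂ h < proj₂ d))

  HexagonalSystem : Set
  HexagonalSystem = Unique S × TwoConnected × NoHoles

  ESet : Set
  ESet = Vec Bool nE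

  _∈E_ : Edge → ESet → Set
  e ∈E X = Σ[ k ∈ Fin nE ] (List.lookup EH k ≡ e × lookup X k ≡ true)

  IsPM : ESet → Set
  IsPM M = ∀ v → v ∈ VH →
    Σ[ e ∈ Edge ] (e ∈E M × Incident v e
                   × (∀ e' → e' ∈E M → Incident v e' → e' ≡ e))

  Kekulean : Set
  Kekulean = Σ[ M ∈ ESet ] IsPM M

  RAdj : ESet → ESet → Set
  RAdj M M' = Σ[ h ∈ Cell ] (h ∈ S ×
    (∀ (k : Fin nE) → ((lookup M k xor lookup M' k) ≡ true) ⇔ (List.lookup EH k ∈ cellEdges h)))

  -- the connected component of the spanning subgraph (V(H), F)
  -- containing the vertices of h is exactly the hexagon h
  HexComp : ESet → Cell → Set
  HexComp F h = h ∈ S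
    × (∀ e → e ∈ cellEdges h → e ∈E F)
    × (∀ e → e ∈E F → ∀ v → v ∈ cellVertices h → Incident v e → e ∈ cellEdges h)

  -- the connected component of (V(H), F) containing e is the single edge e
  EdgeComp : ESet → Edge → Set
  EdgeComp F e = e ∈E F
    × (∀ e' → e' ∈E F → (Incident (proj₁ e) e' ⊎ Incident (proj₂ e) e') → e' ≡ e)

  -- Clar covers: spanning subgraphs (V(H), F) every component of which
  -- is a hexagon of H or a single edge
  ClarCover : ESet → Set
  ClarCover F = ∀ v → v ∈ VH →
    (Σ[ h ∈ Cell ] (HexComp F h × v ∈ cellVertices h))
    ⊎ (Σ[ e ∈ Edge ] (EdgeComp F e × Incident v e))

  NumHex : ESet → ℕ → Set
  NumHex F n = Σ[ L ∈ List Cell ]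
    (Unique L × (∀ h → (h ∈ L) ⇔ HexComp F h) × length L ≡ n)

  AltFrom : ESet → Bool → List Edge → Set
  AltFrom M _ [] = ⊤
  AltFrom M true (e ∷ es) = e ∈E M × AltFrom M false es
  AltFrom M false (e ∷ es) = ¬ (e ∈E M) × AltFrom M true es

  Alternating : ESet → Cell → Set
  Alternating M h = AltFrom M true (cellEdges h) ⊎ AltFrom M false (cellEdges h)

  -- an induced subgraph of R(H) is given by its vertex set, a predicate
  -- W on edge sets (only perfect matchings M count as vertices).
  -- f(C): perfect matchings for which every hexagon of C is alternating and
  -- every single-edge component of C is in M
  fC : ESet → ESet → Set
  fC F M = (∀ h → HexComp F h → Alternating M h)
         × (∀ e → EdgeComp F e → e ∈E M)

  SameInduced : (ESet → Set) → (ESet → Set) → Set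
  SameInduced W W' = ∀ M → IsPM M → W M ⇔ W' M

  QAdj : {n : ℕ} → Vec Bool n → Vec Bool n → Set
  QAdj {n} u v = Σ[ i ∈ Fin n ] (lookup u i ≢ lookup v i
                   × (∀ j → j ≢ i → lookup u j ≡ lookup v j))

  InducesCube : ℕ → (ESet → Set) → Set
  InducesCube n W = Σ[ φ ∈ (Vec Bool n → ESet) ]
      (∀ u → IsPM (φ u) × W (φ u))
    × (∀ u v → φ u ≡ φ v → u ≡ v)
    × (∀ M → IsPM M → W M → Σ[ u ∈ Vec Bool n ] φ u ≡ M)
    × (∀ u v → RAdj (φ u) (φ v) ⇔ QAdj u v)

module Submission where

-- For a Clar cover F with hexagons g₁ … gₙ, the perfect matchings in f(F) are obtained
-- from F by choosing one of the two perfect matchings of every gᵢ independently, and two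
-- of them differ by a single hexagon exactly when they differ on a single gᵢ; so
-- f(F) ≅ Qₙ. Every edge of F lies in some matching of f(F), and every matching of f(F)
-- lies in F, so f(F) determines F.
-- Conversely, let φ : Qₙ → R(H) induce a cube. Opposite edges of a square of Qₙ flip the
-- same hexagon (if A ⊕ B = C ⊕ D for flipped hexagons, D ∉ {A, B, C} would cover D by
-- three other hexagons), so direction i flips one hexagon hᵢ throughout. The hᵢ are
-- distinct, alternating in M₀ = φ(0) and pairwise disjoint; M₀ together with the hᵢ is
-- a Clar cover with n hexagons, and its image under f is the image of φ.

open import Defs
open import Algebra.Bundles using (CommutativeRing)
open import Data.Bool using (Bool; true; false; _xor_; not; _∧_; _∨_)
import Data.Bool.Properties as Bool
open import Data.Empty using (⊥; ⊥-elim)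
open import Data.Fin using (Fin; zero; suc)
import Data.Fin.Properties as Fin
open import Data.Integer as ℤ using (ℤ; +_; -[1+_])
import Data.Integer.Properties as ℤ
open import Data.Integer.Tactic.RingSolver using (solve-∀)
open import Data.List using (List; _∷_; concatMap)
import Data.List as List
open import Data.List.Membership.Propositional using (_∈_; lose; find)
open import Data.List.Membership.Propositional.Properties
  using (∈-lookup; ∈-concatMap⁺; ∈-concatMap⁻; ∈-deduplicate⁺; ∈-deduplicate⁻; ∈-tabulate⁺; ∈-tabulate⁻)
open import Data.List.Membership.DecPropositional _≟E_ using (_∈?_)
open import Data.List.Properties using (length-tabulate)
import Data.List.Relation.Unary.All as All
open import Data.List.Relation.Unary.AllPairs using (_∷_)
open import Data.List.Relation.Unary.Any using (Any; any?; index)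
open import Data.List.Relation.Unary.Any.Properties using (lookup-index)
open import Data.List.Relation.Unary.Unique.Propositional using (Unique)
open import Data.List.Relation.Unary.Unique.Propositional.Properties using (tabulate⁺)
open import Data.List.Relation.Unary.Unique.DecPropositional.Properties _≟E_ using (deduplicate-!)
open import Data.Nat as ℕ using (ℕ; _<_; s≤s; z≤n)
open import Data.Product using (Σ-syntax; _×_; _,_; proj₁; proj₂)
open import Data.Sum using (_⊎_; inj₁; inj₂)
open import Data.Unit using (tt)
open import Data.Vec using (Vec; []; _∷_; lookup; tabulate; replicate; updateAt)
open import Data.Vec.Properties
  using ( lookup∘tabulate; lookup-replicate; lookup-map; lookup∘updateAt; lookup∘updateAt′
        ; updateAt-updateAt; updateAt-id-local; updateAt-commutes)
open import Data.Vec.Relation.Binary.Pointwise.Extensional using (ext; Pointwise-≡⇒≡)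
open import Function using (_∘_)
open import Function.Bundles using (_⇔_; mk⇔; Equivalence)
open import Relation.Nullary using (¬_; Dec; does; yes; no)
open import Relation.Nullary.Decidable using (dec-true; dec-false)
open import Relation.Binary.PropositionalEquality

Unique⇒lookup-injective : ∀ {A : Set} {xs : List A} → Unique xs →
  ∀ k k′ → List.lookup xs k ≡ List.lookup xs k′ → k ≡ k′
Unique⇒lookup-injective (_ ∷ _) zero zero _ = refl
Unique⇒lookup-injective (x∉ ∷ _) zero (suc k′) eq = ⊥-elim (All.lookup x∉ (∈-lookup k′) eq)
Unique⇒lookup-injective (x∉ ∷ _) (suc k) zero eq = ⊥-elim (All.lookup x∉ (∈-lookup k) (sym eq))
Unique⇒lookup-injective (_ ∷ u) (suc k) (suc k′) eq = cong suc (Unique⇒lookup-injective u k k′ eq)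

does-true⁻ : ∀ {A : Set} (a? : Dec A) → does a? ≡ true → A
does-true⁻ (yes a) _ = a

⇔⇒≡does : ∀ {A : Set} b → (b ≡ true ⇔ A) → (a? : Dec A) → b ≡ does a?
⇔⇒≡does true  b⇔A (no ¬a) = ⊥-elim (¬a (Equivalence.to b⇔A refl))
⇔⇒≡does true  _   (yes _) = refl
⇔⇒≡does false b⇔A (yes a) with () ← Equivalence.from b⇔A a
⇔⇒≡does false _   (no _)  = refl


module Geometry where

  open import Algebra.Properties.AbelianGroup ℤ.+-0-abelianGroup using () renaming (∙-cancelˡ to +-cancelˡ)

  -- A position p : Pos names both the p-th vertex and the p-th edge of a cell, in
  -- the order of cellVertices and cellEdges; edge p joins vertices p and p + 1 (mod 6).
  Pos : Set
  Pos = Fin 6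

  pattern p₀ = zero
  pattern p₁ = suc zero
  pattern p₂ = suc (suc zero)
  pattern p₃ = suc (suc (suc zero))
  pattern p₄ = suc (suc (suc (suc zero)))
  pattern p₅ = suc (suc (suc (suc (suc zero))))

  vertexAt : Cell → Pos → Vertex
  vertexAt c = List.lookup (cellVertices c)

  edgeAt : Cell → Pos → Edge
  edgeAt c = List.lookup (cellEdges c)

  vertexAt∈ : ∀ c r → vertexAt c r ∈ cellVertices c
  vertexAt∈ c = ∈-lookup

  edgeAt∈ : ∀ c p → edgeAt c p ∈ cellEdges c
  edgeAt∈ c = ∈-lookup

  ∈⇒vertexAt : ∀ c {v} → v ∈ cellVertices c → Σ[ r ∈ Pos ] vertexAt c r ≡ v
  ∈⇒vertexAt c v∈ = index v∈ , sym (lookup-index v∈)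

  ∈⇒edgeAt : ∀ c {e} → e ∈ cellEdges c → Σ[ p ∈ Pos ] edgeAt c p ≡ e
  ∈⇒edgeAt c e∈ = index e∈ , sym (lookup-index e∈)

  prev : Pos → Pos
  prev p₀ = p₅
  prev p₁ = p₀
  prev p₂ = p₁
  prev p₃ = p₂
  prev p₄ = p₃
  prev p₅ = p₄

  prev≢ : ∀ r → prev r ≢ r
  prev≢ p₀ ()
  prev≢ p₁ ()
  prev≢ p₂ ()
  prev≢ p₃ ()
  prev≢ p₄ ()
  prev≢ p₅ ()

  odd : Pos → Bool
  odd p₀ = false
  odd p₁ = true
  odd p₂ = false
  odd p₃ = true
  odd p₄ = false
  odd p₅ = true

  odd-xor-prev : ∀ r → odd r xor odd (prev r) ≡ true
  odd-xor-prev p₀ = refl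
  odd-xor-prev p₁ = refl
  odd-xor-prev p₂ = refl
  odd-xor-prev p₃ = refl
  odd-xor-prev p₄ = refl
  odd-xor-prev p₅ = refl

  -- Edges are stored with their smaller endpoint first, so edge p runs from
  -- vertex (start p) to vertex (end p).
  start end : Pos → Pos
  start p₀ = p₀
  start p₁ = p₁
  start p₂ = p₂
  start p₃ = p₄
  start p₄ = p₅
  start p₅ = p₀
  end p₀ = p₁
  end p₁ = p₂
  end p₂ = p₃
  end p₃ = p₃
  end p₄ = p₄
  end p₅ = p₅

  edgeAt-endpoints : ∀ c p → edgeAt c p ≡ (vertexAt c (start p) , vertexAt c (end p))
  edgeAt-endpoints c p₀ = refl
  edgeAt-endpoints c p₁ = refl
  edgeAt-endpoints c p₂ = refl
  edgeAt-endpoints c p₃ = refl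
  edgeAt-endpoints c p₄ = refl
  edgeAt-endpoints c p₅ = refl

  edgeAt-incidentʳ : ∀ c r → Incident (vertexAt c r) (edgeAt c r)
  edgeAt-incidentʳ c p₀ = inj₁ refl
  edgeAt-incidentʳ c p₁ = inj₁ refl
  edgeAt-incidentʳ c p₂ = inj₁ refl
  edgeAt-incidentʳ c p₃ = inj₂ refl
  edgeAt-incidentʳ c p₄ = inj₂ refl
  edgeAt-incidentʳ c p₅ = inj₂ refl

  edgeAt-incidentˡ : ∀ c r → Incident (vertexAt c r) (edgeAt c (prev r))
  edgeAt-incidentˡ c p₀ = inj₁ refl
  edgeAt-incidentˡ c p₁ = inj₂ refl
  edgeAt-incidentˡ c p₂ = inj₂ refl
  edgeAt-incidentˡ c p₃ = inj₂ refl
  edgeAt-incidentˡ c p₄ = inj₁ refl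
  edgeAt-incidentˡ c p₅ = inj₁ refl

  edgeAt-incident : ∀ c r p → p ≡ r ⊎ p ≡ prev r → Incident (vertexAt c r) (edgeAt c p)
  edgeAt-incident c r .r (inj₁ refl) = edgeAt-incidentʳ c r
  edgeAt-incident c r ._ (inj₂ refl) = edgeAt-incidentˡ c r

  _⊕_ : ℤ × ℤ → ℤ × ℤ → ℤ × ℤ
  a ⊕ d = (proj₁ a ℤ.+ proj₁ d , proj₂ a ℤ.+ proj₂ d)

  ⊕-identityʳ : ∀ a → a ⊕ (+ 0 , + 0) ≡ a
  ⊕-identityʳ (x , y) = cong₂ _,_ (ℤ.+-identityʳ x) (ℤ.+-identityʳ y)

  ⊕-cancelˡ : ∀ a d d′ → a ⊕ d ≡ a ⊕ d′ → d ≡ d′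
  ⊕-cancelˡ a d d′ eq =
    cong₂ _,_ (+-cancelˡ (proj₁ a) _ _ (cong proj₁ eq)) (+-cancelˡ (proj₂ a) _ _ (cong proj₂ eq))

  _⊖_ : ℤ × ℤ → ℤ × ℤ → ℤ × ℤ
  d ⊖ d′ = (proj₁ d ℤ.- proj₁ d′ , proj₂ d ℤ.- proj₂ d′)

  ⊕-transpose : ∀ a d a′ d′ → a ⊕ d ≡ a′ ⊕ d′ → a′ ≡ a ⊕ (d ⊖ d′)
  ⊕-transpose a d a′ d′ eq =
    cong₂ _,_ (shift (proj₁ a) (proj₁ d) _ _ (cong proj₁ eq)) (shift (proj₂ a) (proj₂ d) _ _ (cong proj₂ eq))
    where
    shift : ∀ x u y v → x ℤ.+ u ≡ y ℤ.+ v → y ≡ x ℤ.+ (u ℤ.- v)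
    shift x u y v e = begin
      y                       ≡⟨ rearrange y v ⟩
      (y ℤ.+ v) ℤ.- v         ≡⟨ cong (ℤ._- v) (sym e) ⟩
      (x ℤ.+ u) ℤ.- v         ≡⟨ +-assoc-sub x u v ⟩
      x ℤ.+ (u ℤ.- v)         ∎
      where
      open ≡-Reasoning
      rearrange : ∀ y v → y ≡ (y ℤ.+ v) ℤ.- v
      rearrange = solve-∀
      +-assoc-sub : ∀ x u v → (x ℤ.+ u) ℤ.- v ≡ x ℤ.+ (u ℤ.- v)
      +-assoc-sub = solve-∀

  offset : Pos → ℤ × ℤ
  offset p₀ = (+ 0 , + 0)
  offset p₁ = (+ 1 , + 0)
  offset p₂ = (+ 2 , + 0)
  offset p₃ = (+ 2 , + 1)
  offset p₄ = (+ 1 , + 1)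
  offset p₅ = (+ 0 , + 1)

  vertexAt-offset : ∀ c r → vertexAt c r ≡ corner c ⊕ offset r
  vertexAt-offset c p₀ = sym (⊕-identityʳ (corner c))
  vertexAt-offset c p₁ = cong₂ _,_ refl (sym (ℤ.+-identityʳ _))
  vertexAt-offset c p₂ = cong₂ _,_ refl (sym (ℤ.+-identityʳ _))
  vertexAt-offset c p₃ = refl
  vertexAt-offset c p₄ = refl
  vertexAt-offset c p₅ = cong₂ _,_ (sym (ℤ.+-identityʳ _)) refl

  offset⁻¹ : ℤ × ℤ → Pos
  offset⁻¹ (+ 0 , + 0) = p₀
  offset⁻¹ (+ 1 , + 0) = p₁
  offset⁻¹ (+ 2 , + 0) = p₂
  offset⁻¹ (+ 2 , + 1) = p₃
  offset⁻¹ (+ 1 , + 1) = p₄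
  offset⁻¹ _ = p₅

  offset⁻¹-offset : ∀ r → offset⁻¹ (offset r) ≡ r
  offset⁻¹-offset p₀ = refl
  offset⁻¹-offset p₁ = refl
  offset⁻¹-offset p₂ = refl
  offset⁻¹-offset p₃ = refl
  offset⁻¹-offset p₄ = refl
  offset⁻¹-offset p₅ = refl

  vertexAt-injective : ∀ c r s → vertexAt c r ≡ vertexAt c s → r ≡ s
  vertexAt-injective c r s eq = begin
    r                        ≡⟨ sym (offset⁻¹-offset r) ⟩
    offset⁻¹ (offset r)      ≡⟨ cong offset⁻¹ (⊕-cancelˡ (corner c) _ _ eq′) ⟩
    offset⁻¹ (offset s)      ≡⟨ offset⁻¹-offset s ⟩
    s                        ∎
    where
    open ≡-Reasoning
    eq′ = trans (sym (vertexAt-offset c r)) (trans eq (vertexAt-offset c s))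

  endpoints⁻¹ : Pos × Pos → Pos
  endpoints⁻¹ (p₀ , p₁) = p₀
  endpoints⁻¹ (p₁ , p₂) = p₁
  endpoints⁻¹ (p₂ , p₃) = p₂
  endpoints⁻¹ (p₄ , p₃) = p₃
  endpoints⁻¹ (p₅ , p₄) = p₄
  endpoints⁻¹ _ = p₅

  endpoints⁻¹-endpoints : ∀ p → endpoints⁻¹ (start p , end p) ≡ p
  endpoints⁻¹-endpoints p₀ = refl
  endpoints⁻¹-endpoints p₁ = refl
  endpoints⁻¹-endpoints p₂ = refl
  endpoints⁻¹-endpoints p₃ = refl
  endpoints⁻¹-endpoints p₄ = refl
  endpoints⁻¹-endpoints p₅ = refl

  edgeAt-injective : ∀ c p q → edgeAt c p ≡ edgeAt c q → p ≡ q
  edgeAt-injective c p q eq = begin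
    p                              ≡⟨ sym (endpoints⁻¹-endpoints p) ⟩
    endpoints⁻¹ (start p , end p)  ≡⟨ cong endpoints⁻¹ (cong₂ _,_ same-start same-end) ⟩
    endpoints⁻¹ (start q , end q)  ≡⟨ endpoints⁻¹-endpoints q ⟩
    q                              ∎
    where
    open ≡-Reasoning
    eq′ = trans (sym (edgeAt-endpoints c p)) (trans eq (edgeAt-endpoints c q))
    same-start = vertexAt-injective c _ _ (cong proj₁ eq′)
    same-end = vertexAt-injective c _ _ (cong proj₂ eq′)

  endpoint⇒adjacentPos : ∀ p r → start p ≡ r ⊎ end p ≡ r → p ≡ r ⊎ p ≡ prev r
  endpoint⇒adjacentPos p₀ .p₀ (inj₁ refl) = inj₁ refl
  endpoint⇒adjacentPos p₁ .p₁ (inj₁ refl) = inj₁ refl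
  endpoint⇒adjacentPos p₂ .p₂ (inj₁ refl) = inj₁ refl
  endpoint⇒adjacentPos p₃ .p₄ (inj₁ refl) = inj₂ refl
  endpoint⇒adjacentPos p₄ .p₅ (inj₁ refl) = inj₂ refl
  endpoint⇒adjacentPos p₅ .p₀ (inj₁ refl) = inj₂ refl
  endpoint⇒adjacentPos p₀ .p₁ (inj₂ refl) = inj₂ refl
  endpoint⇒adjacentPos p₁ .p₂ (inj₂ refl) = inj₂ refl
  endpoint⇒adjacentPos p₂ .p₃ (inj₂ refl) = inj₂ refl
  endpoint⇒adjacentPos p₃ .p₃ (inj₂ refl) = inj₁ refl
  endpoint⇒adjacentPos p₄ .p₄ (inj₂ refl) = inj₁ refl
  endpoint⇒adjacentPos p₅ .p₅ (inj₂ refl) = inj₁ refl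

  incident⇒adjacentPos : ∀ c r p → Incident (vertexAt c r) (edgeAt c p) → p ≡ r ⊎ p ≡ prev r
  incident⇒adjacentPos c r p inc
    with subst (Incident (vertexAt c r)) (edgeAt-endpoints c p) inc
  ... | inj₁ e = endpoint⇒adjacentPos p r (inj₁ (vertexAt-injective c _ _ e))
  ... | inj₂ e = endpoint⇒adjacentPos p r (inj₂ (vertexAt-injective c _ _ e))

  incident⇒vertexAt : ∀ c p {v} → Incident v (edgeAt c p) → Σ[ r ∈ Pos ] vertexAt c r ≡ v
  incident⇒vertexAt c p inc with subst (Incident _) (edgeAt-endpoints c p) inc
  ... | inj₁ e = start p , e
  ... | inj₂ e = end p , e

  -- Cells (i , j) have corners (2i + j , j): a corner shift (a , b) comes from a
  -- cell shift exactly when a - b is even.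
  corner-shift : ∀ c c′ k b → corner c′ ≡ corner c ⊕ (+ 2 ℤ.* k ℤ.+ b , b) → c′ ≡ c ⊕ (k , b)
  corner-shift (i , j) (i′ , j′) k b eq with cong proj₂ eq
  ... | refl = cong (_, _) (ℤ.*-cancelˡ-≡ (+ 2) i′ (i ℤ.+ k) (begin
    + 2 ℤ.* i′                                            ≡⟨ rearrange i′ j b ⟩
    (+ 2 ℤ.* i′ ℤ.+ (j ℤ.+ b)) ℤ.- (j ℤ.+ b)              ≡⟨ cong (ℤ._- (j ℤ.+ b)) (cong proj₁ eq) ⟩
    ((+ 2 ℤ.* i ℤ.+ j) ℤ.+ (+ 2 ℤ.* k ℤ.+ b)) ℤ.- (j ℤ.+ b) ≡⟨ collect i j k b ⟩
    + 2 ℤ.* (i ℤ.+ k)                                     ∎))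
    where
    open ≡-Reasoning
    rearrange : ∀ i′ j b → + 2 ℤ.* i′ ≡ (+ 2 ℤ.* i′ ℤ.+ (j ℤ.+ b)) ℤ.- (j ℤ.+ b)
    rearrange = solve-∀
    collect : ∀ i j k b → ((+ 2 ℤ.* i ℤ.+ j) ℤ.+ (+ 2 ℤ.* k ℤ.+ b)) ℤ.- (j ℤ.+ b) ≡ + 2 ℤ.* (i ℤ.+ k)
    collect = solve-∀

  corner-unshifted : ∀ c c′ → corner c′ ≡ corner c ⊕ (+ 0 , + 0) → c′ ≡ c
  corner-unshifted c c′ eq = trans (corner-shift c c′ (+ 0) (+ 0) eq) (⊕-identityʳ c)

  2*≢1 : ∀ z → + 2 ℤ.* z ≢ + 1
  2*≢1 (+ 0) ()
  2*≢1 (+ 1) ()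
  2*≢1 (+ ℕ.suc (ℕ.suc n)) ()
  2*≢1 -[1+ n ] ()

  corner-oddShift : ∀ c c′ k b → corner c′ ≢ corner c ⊕ (+ 2 ℤ.* k ℤ.+ + 1 ℤ.+ b , b)
  corner-oddShift (i , j) (i′ , j′) k b eq with cong proj₂ eq
  ... | refl = 2*≢1 (i′ ℤ.- i ℤ.- k) (begin
    + 2 ℤ.* (i′ ℤ.- i ℤ.- k)                                           ≡⟨ expand i′ j b i k ⟩
    (+ 2 ℤ.* i′ ℤ.+ (j ℤ.+ b)) ℤ.- (+ 2 ℤ.* i ℤ.+ j ℤ.+ + 2 ℤ.* k ℤ.+ b) ≡⟨ cong (ℤ._- _) (cong proj₁ eq) ⟩
    ((+ 2 ℤ.* i ℤ.+ j) ℤ.+ (+ 2 ℤ.* k ℤ.+ + 1 ℤ.+ b)) ℤ.- (+ 2 ℤ.* i ℤ.+ j ℤ.+ + 2 ℤ.* k ℤ.+ b)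
                                                                       ≡⟨ collect i j k b ⟩
    + 1                                                                ∎)
    where
    open ≡-Reasoning
    expand : ∀ i′ j b i k → + 2 ℤ.* (i′ ℤ.- i ℤ.- k) ≡ (+ 2 ℤ.* i′ ℤ.+ (j ℤ.+ b)) ℤ.- (+ 2 ℤ.* i ℤ.+ j ℤ.+ + 2 ℤ.* k ℤ.+ b)
    expand = solve-∀
    collect : ∀ i j k b → ((+ 2 ℤ.* i ℤ.+ j) ℤ.+ (+ 2 ℤ.* k ℤ.+ + 1 ℤ.+ b)) ℤ.- (+ 2 ℤ.* i ℤ.+ j ℤ.+ + 2 ℤ.* k ℤ.+ b) ≡ + 1
    collect = solve-∀

  neighbourShift : Pos → ℤ × ℤ
  neighbourShift p₀ = (+ 0 , -[1+ 0 ])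
  neighbourShift p₁ = (+ 1 , -[1+ 0 ])
  neighbourShift p₂ = (+ 1 , + 0)
  neighbourShift p₃ = (+ 0 , + 1)
  neighbourShift p₄ = (-[1+ 0 ] , + 1)
  neighbourShift p₅ = (-[1+ 0 ] , + 0)

  -- the cell on the other side of edge p of c
  neighbour : Pos → Cell → Cell
  neighbour p c = c ⊕ neighbourShift p

  neighbourShift⁻¹ : ℤ × ℤ → Pos
  neighbourShift⁻¹ (+ 0 , -[1+ 0 ]) = p₀
  neighbourShift⁻¹ (+ 1 , -[1+ 0 ]) = p₁
  neighbourShift⁻¹ (+ 1 , + 0) = p₂
  neighbourShift⁻¹ (+ 0 , + 1) = p₃
  neighbourShift⁻¹ (-[1+ 0 ] , + 1) = p₄
  neighbourShift⁻¹ _ = p₅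

  neighbourShift⁻¹-neighbourShift : ∀ p → neighbourShift⁻¹ (neighbourShift p) ≡ p
  neighbourShift⁻¹-neighbourShift p₀ = refl
  neighbourShift⁻¹-neighbourShift p₁ = refl
  neighbourShift⁻¹-neighbourShift p₂ = refl
  neighbourShift⁻¹-neighbourShift p₃ = refl
  neighbourShift⁻¹-neighbourShift p₄ = refl
  neighbourShift⁻¹-neighbourShift p₅ = refl

  neighbour-injective : ∀ c p q → neighbour p c ≡ neighbour q c → p ≡ q
  neighbour-injective c p q eq = begin
    p                                       ≡⟨ sym (neighbourShift⁻¹-neighbourShift p) ⟩
    neighbourShift⁻¹ (neighbourShift p)     ≡⟨ cong neighbourShift⁻¹ (⊕-cancelˡ c _ _ eq) ⟩
    neighbourShift⁻¹ (neighbourShift q)     ≡⟨ neighbourShift⁻¹-neighbourShift q ⟩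
    q                                       ∎
    where open ≡-Reasoning

  displacement : Pos → Pos → ℤ × ℤ
  displacement r s = offset r ⊖ offset s

  -- Both endpoints of a shared edge give the same corner displacement; the
  -- remaining cases either contradict the parity of corners or are the two
  -- cells c and neighbour p c.
  sharedEdge-cases : ∀ p q c c′ → corner c′ ≡ corner c ⊕ displacement (start p) (start q)
    → displacement (start p) (start q) ≡ displacement (end p) (end q) → c′ ≡ c ⊎ c′ ≡ neighbour p c
  sharedEdge-cases p₀ p₀ c c′ e _ = inj₁ (corner-unshifted c c′ e)
  sharedEdge-cases p₀ p₁ c c′ e _ = ⊥-elim (corner-oddShift c c′ (-[1+ 0 ]) (+ 0) e)
  sharedEdge-cases p₀ p₂ c c′ e ()
  sharedEdge-cases p₀ p₃ c c′ e _ = inj₂ (corner-shift c c′ (+ 0) (-[1+ 0 ]) e)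
  sharedEdge-cases p₀ p₄ c c′ e _ = ⊥-elim (corner-oddShift c c′ (+ 0) (-[1+ 0 ]) e)
  sharedEdge-cases p₀ p₅ c c′ e ()
  sharedEdge-cases p₁ p₀ c c′ e _ = ⊥-elim (corner-oddShift c c′ (+ 0) (+ 0) e)
  sharedEdge-cases p₁ p₁ c c′ e _ = inj₁ (corner-unshifted c c′ e)
  sharedEdge-cases p₁ p₂ c c′ e ()
  sharedEdge-cases p₁ p₃ c c′ e _ = ⊥-elim (corner-oddShift c c′ (+ 0) (-[1+ 0 ]) e)
  sharedEdge-cases p₁ p₄ c c′ e _ = inj₂ (corner-shift c c′ (+ 1) (-[1+ 0 ]) e)
  sharedEdge-cases p₁ p₅ c c′ e ()
  sharedEdge-cases p₂ p₀ c c′ e ()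
  sharedEdge-cases p₂ p₁ c c′ e ()
  sharedEdge-cases p₂ p₂ c c′ e _ = inj₁ (corner-unshifted c c′ e)
  sharedEdge-cases p₂ p₃ c c′ e ()
  sharedEdge-cases p₂ p₄ c c′ e ()
  sharedEdge-cases p₂ p₅ c c′ e _ = inj₂ (corner-shift c c′ (+ 1) (+ 0) e)
  sharedEdge-cases p₃ p₀ c c′ e _ = inj₂ (corner-shift c c′ (+ 0) (+ 1) e)
  sharedEdge-cases p₃ p₁ c c′ e _ = ⊥-elim (corner-oddShift c c′ (-[1+ 0 ]) (+ 1) e)
  sharedEdge-cases p₃ p₂ c c′ e ()
  sharedEdge-cases p₃ p₃ c c′ e _ = inj₁ (corner-unshifted c c′ e)
  sharedEdge-cases p₃ p₄ c c′ e _ = ⊥-elim (corner-oddShift c c′ (+ 0) (+ 0) e)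
  sharedEdge-cases p₃ p₅ c c′ e ()
  sharedEdge-cases p₄ p₀ c c′ e _ = ⊥-elim (corner-oddShift c c′ (-[1+ 0 ]) (+ 1) e)
  sharedEdge-cases p₄ p₁ c c′ e _ = inj₂ (corner-shift c c′ (-[1+ 0 ]) (+ 1) e)
  sharedEdge-cases p₄ p₂ c c′ e ()
  sharedEdge-cases p₄ p₃ c c′ e _ = ⊥-elim (corner-oddShift c c′ (-[1+ 0 ]) (+ 0) e)
  sharedEdge-cases p₄ p₄ c c′ e _ = inj₁ (corner-unshifted c c′ e)
  sharedEdge-cases p₄ p₅ c c′ e ()
  sharedEdge-cases p₅ p₀ c c′ e ()
  sharedEdge-cases p₅ p₁ c c′ e ()
  sharedEdge-cases p₅ p₂ c c′ e _ = inj₂ (corner-shift c c′ (-[1+ 0 ]) (+ 0) e)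
  sharedEdge-cases p₅ p₃ c c′ e ()
  sharedEdge-cases p₅ p₄ c c′ e ()
  sharedEdge-cases p₅ p₅ c c′ e _ = inj₁ (corner-unshifted c c′ e)

  sharedEdge : ∀ c c′ p q → edgeAt c p ≡ edgeAt c′ q → c′ ≡ c ⊎ c′ ≡ neighbour p c
  sharedEdge c c′ p q eq = sharedEdge-cases p q c c′ corner-start
    (⊕-cancelˡ (corner c) _ _ (trans (sym corner-start) corner-end))
    where
    eq′ = trans (sym (edgeAt-endpoints c p)) (trans eq (edgeAt-endpoints c′ q))
    cornerVia : ∀ r s → vertexAt c r ≡ vertexAt c′ s → corner c′ ≡ corner c ⊕ displacement r s
    cornerVia r s e = ⊕-transpose (corner c) (offset r) (corner c′) (offset s)
      (trans (sym (vertexAt-offset c r)) (trans e (vertexAt-offset c′ s)))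
    corner-start = cornerVia (start p) (start q) (cong proj₁ eq′)
    corner-end = cornerVia (end p) (end q) (cong proj₂ eq′)

  sharesTwoEdges⇒≡ : ∀ c c′ p q p′ q′ → p ≢ p′ →
    edgeAt c p ≡ edgeAt c′ q → edgeAt c p′ ≡ edgeAt c′ q′ → c′ ≡ c
  sharesTwoEdges⇒≡ c c′ p q p′ q′ p≢p′ e e′ with sharedEdge c c′ p q e | sharedEdge c c′ p′ q′ e′
  ... | inj₁ c′≡c | _ = c′≡c
  ... | inj₂ _ | inj₁ c′≡c = c′≡c
  ... | inj₂ c′≡n | inj₂ c′≡n′ = ⊥-elim (p≢p′ (neighbour-injective c p p′ (trans (sym c′≡n) c′≡n′)))


module XorSums where

  open CommutativeRing Bool.xor-∧-commutativeRing using (+-commutativeSemigroup; +-abelianGroup; semiring)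
  open import Algebra.Properties.AbelianGroup +-abelianGroup
    using () renaming (∙-cancelˡ to xor-cancelˡ; ∙-cancelʳ to xor-cancelʳ) public
  open import Algebra.Properties.CommutativeSemigroup +-commutativeSemigroup
    using () renaming (interchange to xor-interchange) public
  open import Algebra.Properties.Semiring.Sum semiring using (sum) public
  open import Algebra.Properties.Semiring.Sum semiring using (sum-cong-≗; ∑-distrib-+; sum-replicate-zero)

  xor-solve : ∀ a b c → a xor b ≡ c → b ≡ a xor c
  xor-solve a b c eq = begin
    b                  ≡⟨ sym (Bool.xor-identityˡ b) ⟩
    false xor b        ≡⟨ cong (_xor b) (sym (Bool.xor-same a)) ⟩
    (a xor a) xor b    ≡⟨ Bool.xor-assoc a a b ⟩
    a xor (a xor b)    ≡⟨ cong (a xor_) eq ⟩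
    a xor c            ∎
    where open ≡-Reasoning

  sum-false : ∀ {n} (f : Fin n → Bool) → (∀ i → f i ≡ false) → sum f ≡ false
  sum-false {n} f f≡false = trans (sum-cong-≗ f≡false) (sum-replicate-zero n)

  sum-single : ∀ {n} (f : Fin n → Bool) i → (∀ j → j ≢ i → f j ≡ false) → sum f ≡ f i
  sum-single f zero others =
    trans (cong (f zero xor_) (sum-false (f ∘ suc) (λ j → others (suc j) (λ ())))) (Bool.xor-identityʳ (f zero))
  sum-single f (suc i) others =
    trans (cong (_xor sum (f ∘ suc)) (others zero (λ ())))
          (sum-single (f ∘ suc) i (λ j j≢i → others (suc j) (j≢i ∘ Fin.suc-injective)))

  sum-∧-xor : ∀ {n} (u v a : Fin n → Bool) →
    sum (λ i → u i ∧ a i) xor sum (λ i → v i ∧ a i) ≡ sum (λ i → (u i xor v i) ∧ a i)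
  sum-∧-xor u v a = trans (sym (∑-distrib-+ (λ i → u i ∧ a i) (λ i → v i ∧ a i)))
    (sum-cong-≗ (λ i → sym (Bool.∧-distribʳ-xor (a i) (u i) (v i))))

  xor≡false⇒≡ : ∀ a b → a xor b ≡ false → a ≡ b
  xor≡false⇒≡ a b eq = sym (trans (xor-solve a b false eq) (Bool.xor-identityʳ a))

  xor≡true⇒≢ : ∀ a b → a xor b ≡ true → a ≢ b
  xor≡true⇒≢ a b eq a≡b = Bool.not-¬ (sym a≡b) (trans (xor-solve a b true eq) (Bool.xor-comm a true))

  complementary-flip : ∀ x y s t → x xor y ≡ true → (x xor s) xor (y xor t) ≡ true → s ≡ t
  complementary-flip x y s t xy eq = xor≡false⇒≡ s t (Bool.not-injective (begin
    not (s xor t)             ≡⟨ cong (_xor (s xor t)) (sym xy) ⟩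
    (x xor y) xor (s xor t)   ≡⟨ xor-interchange x y s t ⟩
    (x xor s) xor (y xor t)   ≡⟨ eq ⟩
    true                      ∎))
    where open ≡-Reasoning


module Cube where

  flip : ∀ {n} → Vec Bool n → Fin n → Vec Bool n
  flip u i = updateAt u i not

  lookup-flip : ∀ {n} (u : Vec Bool n) i → lookup (flip u i) i ≡ not (lookup u i)
  lookup-flip u i = lookup∘updateAt i u

  lookup-flip′ : ∀ {n} (u : Vec Bool n) i j → j ≢ i → lookup (flip u i) j ≡ lookup u j
  lookup-flip′ u i j j≢i = lookup∘updateAt′ j i j≢i u

  lookup-flip-≢ : ∀ {n} (u : Vec Bool n) i → lookup (flip u i) i ≢ lookup u i
  lookup-flip-≢ u i eq = Bool.not-¬ {lookup u i} refl (trans (sym eq) (lookup-flip u i))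

  flip-involutive : ∀ {n} (u : Vec Bool n) i → flip (flip u i) i ≡ u
  flip-involutive u i = trans (updateAt-updateAt i u) (updateAt-id-local i u (Bool.not-involutive _))

  flip-comm : ∀ {n} (u : Vec Bool n) i j → i ≢ j → flip (flip u i) j ≡ flip (flip u j) i
  flip-comm u i j i≢j = updateAt-commutes j i (i≢j ∘ sym) u

  cube-induction : ∀ {n} (P : Vec Bool n → Set) → P (replicate n false) →
    (∀ u i → lookup u i ≡ false → P u → P (flip u i)) → ∀ u → P u

  cube-induction-false : ∀ {n} (P : Vec Bool (ℕ.suc n) → Set) → P (replicate (ℕ.suc n) false) →
    (∀ u i → lookup u i ≡ false → P u → P (flip u i)) → ∀ u → P (false ∷ u)

  cube-induction P base flip-step [] = base
  cube-induction P base flip-step (false ∷ u) = cube-induction-false P base flip-step u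
  cube-induction P base flip-step (true ∷ u) = flip-step (false ∷ u) zero refl (cube-induction-false P base flip-step u)

  cube-induction-false P base flip-step = cube-induction (P ∘ (false ∷_)) base (λ u i → flip-step (false ∷ u) (suc i))


module Edges (S : List Cell) where

  open Geometry

  edgeOf : Fin (nE S) → Edge
  edgeOf = List.lookup (EH S)

  edgeOf-injective : ∀ k k′ → edgeOf k ≡ edgeOf k′ → k ≡ k′
  edgeOf-injective = Unique⇒lookup-injective (deduplicate-! (concatMap cellEdges S))

  edgeAt∈EH : ∀ {h} → h ∈ S → ∀ p → edgeAt h p ∈ EH S
  edgeAt∈EH {h} h∈S p = ∈-deduplicate⁺ _≟E_ (∈-concatMap⁺ cellEdges (lose h∈S (edgeAt∈ h p)))

  -- Abstract, so that indexOf never unfolds into the search through EH S (which is slow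
  -- and blocks inference of membership proofs).
  abstract
    indexOf : ∀ {h} → h ∈ S → Pos → Fin (nE S)
    indexOf h∈S p = index (edgeAt∈EH h∈S p)

    edgeOf-indexOf : ∀ {h} (h∈S : h ∈ S) p → edgeOf (indexOf h∈S p) ≡ edgeAt h p
    edgeOf-indexOf h∈S p = sym (lookup-index (edgeAt∈EH h∈S p))

  indexOf-unique : ∀ {h} (h∈S : h ∈ S) p k → edgeOf k ≡ edgeAt h p → indexOf h∈S p ≡ k
  indexOf-unique h∈S p k eq = edgeOf-injective _ _ (trans (edgeOf-indexOf h∈S p) (sym eq))

  indexOf-cong : ∀ {h h′} (h∈S : h ∈ S) (h′∈S : h′ ∈ S) → h ≡ h′ → ∀ p → indexOf h∈S p ≡ indexOf h′∈S p
  indexOf-cong h∈S h′∈S refl p = indexOf-unique h∈S p _ (edgeOf-indexOf h′∈S p)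

  edgeOf-inCell : ∀ k → Σ[ h ∈ Cell ] Σ[ p ∈ Pos ] (h ∈ S × edgeAt h p ≡ edgeOf k)
  edgeOf-inCell k with find (∈-concatMap⁻ cellEdges (∈-deduplicate⁻ _≟E_ _ (∈-lookup k)))
  ... | h , h∈S , e∈h = h , proj₁ (∈⇒edgeAt h e∈h) , h∈S , proj₂ (∈⇒edgeAt h e∈h)

  vertexAt∈VH : ∀ {h} → h ∈ S → ∀ r → vertexAt h r ∈ VH S
  vertexAt∈VH {h} h∈S r = ∈-concatMap⁺ cellVertices (lose h∈S (vertexAt∈ h r))

  incident⇒∈VH : ∀ k {v} → Incident v (edgeOf k) → v ∈ VH S
  incident⇒∈VH k {v} inc with edgeOf-inCell k
  ... | h , p , h∈S , eq with incident⇒vertexAt h p (subst (Incident v) (sym eq) inc)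
  ... | r , refl = vertexAt∈VH h∈S r

  ∈E⇒bit : ∀ (M : ESet S) k {e} → edgeOf k ≡ e → _∈E_ S e M → lookup M k ≡ true
  ∈E⇒bit M k eq (k′ , eq′ , bit) with edgeOf-injective k k′ (trans eq (sym eq′))
  ... | refl = bit

  bit⇒∈E : ∀ (M : ESet S) k → lookup M k ≡ true → _∈E_ S (edgeOf k) M
  bit⇒∈E M k bit = k , refl , bit

  IsPM-unique : ∀ {M} → IsPM S M → ∀ {v e e′} → v ∈ VH S →
    _∈E_ S e M → Incident v e → _∈E_ S e′ M → Incident v e′ → e ≡ e′
  IsPM-unique pm {v} v∈ e∈M inc e′∈M inc′ with pm v v∈
  ... | _ , _ , _ , unique = trans (unique _ e∈M inc) (sym (unique _ e′∈M inc′))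

  IsPM-unique-index : ∀ {M} → IsPM S M → ∀ {v} k k′ → lookup M k ≡ true → lookup M k′ ≡ true →
    Incident v (edgeOf k) → Incident v (edgeOf k′) → k ≡ k′
  IsPM-unique-index {M} pm k k′ bit bit′ inc inc′ =
    edgeOf-injective k k′ (IsPM-unique {M} pm (incident⇒∈VH k inc) (bit⇒∈E M k bit) inc (bit⇒∈E M k′ bit′) inc′)

  inCell : Fin (nE S) → Cell → Bool
  inCell k h = does (edgeOf k ∈? cellEdges h)

  inCell-true⁺ : ∀ k h → edgeOf k ∈ cellEdges h → inCell k h ≡ true
  inCell-true⁺ k h = dec-true (edgeOf k ∈? cellEdges h)

  inCell-false⁺ : ∀ k h → ¬ edgeOf k ∈ cellEdges h → inCell k h ≡ false
  inCell-false⁺ k h = dec-false (edgeOf k ∈? cellEdges h)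

  inCell-true⁻ : ∀ k h → inCell k h ≡ true → edgeOf k ∈ cellEdges h
  inCell-true⁻ k h = does-true⁻ (edgeOf k ∈? cellEdges h)

  inCell⇒edgeAt : ∀ k h → inCell k h ≡ true → Σ[ p ∈ Pos ] edgeAt h p ≡ edgeOf k
  inCell⇒edgeAt k h k∈h = ∈⇒edgeAt h (inCell-true⁻ k h k∈h)

  inCell-indexOf : ∀ {h} (h∈S : h ∈ S) p → inCell (indexOf h∈S p) h ≡ true
  inCell-indexOf {h} h∈S p =
    inCell-true⁺ _ h (subst (_∈ cellEdges h) (sym (edgeOf-indexOf h∈S p)) (edgeAt∈ h p))

  inCell-twice⇒≡ : ∀ {h} (h∈S : h ∈ S) h′ p p′ → p ≢ p′ →
    inCell (indexOf h∈S p) h′ ≡ true → inCell (indexOf h∈S p′) h′ ≡ true → h′ ≡ h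
  inCell-twice⇒≡ {h} h∈S h′ p p′ p≢p′ in₁ in₂
    with inCell⇒edgeAt _ h′ in₁ | inCell⇒edgeAt _ h′ in₂
  ... | q , eq | q′ , eq′ = sharesTwoEdges⇒≡ h h′ p q p′ q′ p≢p′
    (trans (sym (edgeOf-indexOf h∈S p)) (sym eq)) (trans (sym (edgeOf-indexOf h∈S p′)) (sym eq′))

  incident-indexOf : ∀ {h} (h∈S : h ∈ S) r p → p ≡ r ⊎ p ≡ prev r → Incident (vertexAt h r) (edgeOf (indexOf h∈S p))
  incident-indexOf {h} h∈S r p adj = subst (Incident (vertexAt h r)) (sym (edgeOf-indexOf h∈S p)) (edgeAt-incident h r p adj)

  incident-endpoint : ∀ {v e e′} → Incident v e → Incident v e′ → Incident (proj₁ e) e′ ⊎ Incident (proj₂ e) e′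
  incident-endpoint (inj₁ refl) inc = inj₁ inc
  incident-endpoint (inj₂ refl) inc = inj₂ inc

  oddPosition : ∀ e h → Dec (e ∈ cellEdges h) → Bool
  oddPosition e h (yes e∈h) = odd (index e∈h)
  oddPosition e h (no _) = false

  oddIn : Fin (nE S) → Cell → Bool
  oddIn k h = oddPosition (edgeOf k) h (edgeOf k ∈? cellEdges h)

  oddIn-indexOf : ∀ {h} (h∈S : h ∈ S) q → oddIn (indexOf h∈S q) h ≡ odd q
  oddIn-indexOf {h} h∈S q = at-position (edgeOf-indexOf h∈S q) (edgeOf (indexOf h∈S q) ∈? cellEdges h)
    where
    at-position : ∀ {e} → e ≡ edgeAt h q → (d : Dec (e ∈ cellEdges h)) → oddPosition e h d ≡ odd q
    at-position e≡ (yes e∈h) = cong odd (edgeAt-injective h _ _ (trans (sym (lookup-index e∈h)) e≡))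
    at-position refl (no e∉h) = ⊥-elim (e∉h (edgeAt∈ h q))


module Resonance (S : List Cell) where

  open Geometry
  open Edges S
  open XorSums using (xor-solve; xor-cancelʳ)

  ES : Set
  ES = ESet S

  bit : ES → Fin (nE S) → Bool
  bit = lookup

  record HexFlip (M M′ : ES) (h : Cell) : Set where
    constructor _,_
    field
      hexagon∈S : h ∈ S
      flips : ∀ k → bit M k xor bit M′ k ≡ inCell k h

  RAdj⇒HexFlip : ∀ {M M′} → RAdj S M M′ → Σ[ h ∈ Cell ] HexFlip M M′ h
  RAdj⇒HexFlip (h , h∈S , flips) = h , (h∈S , λ k → ⇔⇒≡does _ (flips k) (edgeOf k ∈? cellEdges h))

  HexFlip⇒RAdj : ∀ {M M′ h} → HexFlip M M′ h → RAdj S M M′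
  HexFlip⇒RAdj {h = h} (h∈S , flips) = h , h∈S , λ k →
    mk⇔ (λ t → inCell-true⁻ k h (trans (sym (flips k)) t)) (λ k∈h → trans (flips k) (inCell-true⁺ k h k∈h))

  HexFlip-sym : ∀ {M M′ h} → HexFlip M M′ h → HexFlip M′ M h
  HexFlip-sym {M} {M′} (h∈S , flips) = h∈S , λ k → trans (Bool.xor-comm (bit M′ k) (bit M k)) (flips k)

  HexFlip-target : ∀ {M M′ h} → HexFlip M M′ h → ∀ k → bit M′ k ≡ bit M k xor inCell k h
  HexFlip-target {M} {M′} (_ , flips) k = xor-solve (bit M k) (bit M′ k) _ (flips k)

  HexFlip-deterministic : ∀ {M M₁ M₂ h} → HexFlip M M₁ h → HexFlip M M₂ h → M₁ ≡ M₂
  HexFlip-deterministic {M} {M₁} {M₂} {h} fl₁ fl₂ =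
    Pointwise-≡⇒≡ (ext λ k → trans (HexFlip-target {M} {M₁} {h} fl₁ k) (sym (HexFlip-target {M} {M₂} {h} fl₂ k)))

  HexFlip-hexagon-unique : ∀ {M M′ h h′} → HexFlip M M′ h → HexFlip M M′ h′ → h′ ≡ h
  HexFlip-hexagon-unique {M} {M′} {h} {h′} (h∈S , flips) (_ , flips′) =
    inCell-twice⇒≡ h∈S h′ p₀ p₁ (λ ()) (on-h′ p₀) (on-h′ p₁)
    where
    on-h′ : ∀ p → inCell (indexOf h∈S p) h′ ≡ true
    on-h′ p = trans (sym (flips′ _)) (trans (flips _) (inCell-indexOf h∈S p))

  hexagon-not-covered : ∀ {D} (D∈S : D ∈ S) {m} → m < 6 → (A : Fin m → Cell) → (∀ l → A l ≢ D) →
    ¬ (∀ p → Σ[ l ∈ Fin m ] inCell (indexOf D∈S p) (A l) ≡ true)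
  hexagon-not-covered D∈S m<6 A A≢D cover with Fin.pigeonhole m<6 (proj₁ ∘ cover)
  ... | p , p′ , p<p′ , same = A≢D (proj₁ (cover p′)) (inCell-twice⇒≡ D∈S _ p p′ (Fin.<⇒≢ p<p′)
    (subst (λ l → inCell (indexOf D∈S p) (A l) ≡ true) same (proj₂ (cover p))) (proj₂ (cover p′)))

  -- If D ≢ A, then either D = B, which forces A = C, or every edge of D lies in A, B or C.
  hexagon-square : ∀ {A D} (A∈S : A ∈ S) (D∈S : D ∈ S) B C →
    (∀ k → inCell k A xor inCell k B ≡ inCell k C xor inCell k D) → A ≢ C → D ≢ C → D ≡ A
  hexagon-square {A} {D} A∈S D∈S B C square A≢C D≢C = by-cases (D ≟V A) (D ≟V B)
    where
    cells : Vec Cell 3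
    cells = A ∷ B ∷ C ∷ []
    one-of-three : ∀ a b c → a xor b ≡ c xor true → Σ[ l ∈ Fin 3 ] lookup (a ∷ b ∷ c ∷ []) l ≡ true
    one-of-three true _ _ _ = zero , refl
    one-of-three false true _ _ = suc zero , refl
    one-of-three false false true _ = suc (suc zero) , refl
    covered : ∀ p → Σ[ l ∈ Fin 3 ] inCell (indexOf D∈S p) (lookup cells l) ≡ true
    covered p = l , trans (sym (lookup-map l (inCell k) cells)) l-true
      where
      k = indexOf D∈S p
      found = one-of-three (inCell k A) (inCell k B) (inCell k C) (trans (square k) (cong (inCell k C xor_) (inCell-indexOf D∈S p)))
      l = proj₁ found
      l-true = proj₂ found
    A-edge-in-C : D ≡ B → ∀ p → inCell (indexOf A∈S p) C ≡ true
    A-edge-in-C D≡B p = sym (trans (sym (inCell-indexOf A∈S p))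
      (xor-cancelʳ _ _ _ (trans (square k) (cong (λ X → inCell k C xor inCell k X) D≡B))))
      where k = indexOf A∈S p
    by-cases : Dec (D ≡ A) → Dec (D ≡ B) → D ≡ A
    by-cases (yes D≡A) _ = D≡A
    by-cases (no _) (yes D≡B) =
      ⊥-elim (A≢C (sym (inCell-twice⇒≡ A∈S C p₀ p₁ (λ ()) (A-edge-in-C D≡B p₀) (A-edge-in-C D≡B p₁))))
    by-cases (no D≢A) (no D≢B) = ⊥-elim (hexagon-not-covered D∈S (s≤s (s≤s (s≤s (s≤s z≤n)))) (lookup cells)
      (λ { zero → D≢A ∘ sym ; (suc zero) → D≢B ∘ sym ; (suc (suc zero)) → D≢C ∘ sym }) covered)


module Alternation (S : List Cell) where

  open Geometry
  open Edges S
  open Resonance S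
  open XorSums using (xor-solve; xor-interchange; complementary-flip)

  AlternatesAt : ES → ∀ {h} → h ∈ S → Pos → Set
  AlternatesAt M h∈S r = bit M (indexOf h∈S r) xor bit M (indexOf h∈S (prev r)) ≡ true

  AlternatesAt-irrelevant : ∀ {M h} (h∈S h∈S′ : h ∈ S) r → AlternatesAt M h∈S r → AlternatesAt M h∈S′ r
  AlternatesAt-irrelevant {M} h∈S h∈S′ r =
    subst₂ (λ k k′ → bit M k xor bit M k′ ≡ true) (indexOf-cong h∈S h∈S′ refl r) (indexOf-cong h∈S h∈S′ refl (prev r))

  IsPM⇒¬bothAt : ∀ {M h} (h∈S : h ∈ S) → IsPM S M → ∀ r →
    bit M (indexOf h∈S r) ≡ true → bit M (indexOf h∈S (prev r)) ≡ true → ⊥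
  IsPM⇒¬bothAt {M} {h} h∈S pm r b b′ = prev≢ r (sym (edgeAt-injective h r (prev r) (begin
    edgeAt h r                      ≡⟨ sym (edgeOf-indexOf h∈S r) ⟩
    edgeOf (indexOf h∈S r)          ≡⟨ cong edgeOf same-index ⟩
    edgeOf (indexOf h∈S (prev r))   ≡⟨ edgeOf-indexOf h∈S (prev r) ⟩
    edgeAt h (prev r)               ∎)))
    where
    open ≡-Reasoning
    same-index = IsPM-unique-index {M} pm _ _ b b′
      (incident-indexOf h∈S r r (inj₁ refl)) (incident-indexOf h∈S r (prev r) (inj₂ refl))

  -- Both edges of h at r change under the flip, and neither M nor M′ contains both.
  HexFlip⇒AlternatesAt : ∀ {M M′ h} → IsPM S M → IsPM S M′ → (fl : HexFlip M M′ h) →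
    ∀ r → AlternatesAt M (HexFlip.hexagon∈S fl) r
  HexFlip⇒AlternatesAt {M} {M′} pm pm′ (h∈S , flips) r =
    exactly-one _ _ _ _ (trans (flips _) (inCell-indexOf h∈S r)) (trans (flips _) (inCell-indexOf h∈S (prev r)))
      (IsPM⇒¬bothAt {M} h∈S pm r) (IsPM⇒¬bothAt {M′} h∈S pm′ r)
    where
    exactly-one : ∀ a b a′ b′ → a xor a′ ≡ true → b xor b′ ≡ true →
      (a ≡ true → b ≡ true → ⊥) → (a′ ≡ true → b′ ≡ true → ⊥) → a xor b ≡ true
    exactly-one true true _ _ _ _ ¬both _ = ⊥-elim (¬both refl refl)
    exactly-one true false _ _ _ _ _ _ = refl
    exactly-one false true _ _ _ _ _ _ = refl
    exactly-one false false true true _ _ _ ¬both′ = ⊥-elim (¬both′ refl refl)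
    exactly-one false false false _ () _ _ _
    exactly-one false false true false _ () _ _

  AlternatingBits : ES → ∀ {h} → h ∈ S → Set
  AlternatingBits M h∈S = ∀ q → bit M (indexOf h∈S q) ≡ bit M (indexOf h∈S p₀) xor odd q

  AlternatesAt⇒AlternatingBits : ∀ {M h} (h∈S : h ∈ S) → (∀ r → AlternatesAt M h∈S r) → AlternatingBits M h∈S
  AlternatesAt⇒AlternatingBits {M} h∈S alt = bits
    where
    b : Pos → Bool
    b q = bit M (indexOf h∈S q)
    flipBit : ∀ r → b (prev r) ≡ b p₀ xor odd (prev r) → b r ≡ b p₀ xor not (odd (prev r))
    flipBit r eq = begin
      b r                              ≡⟨ xor-solve (b (prev r)) (b r) true (trans (Bool.xor-comm (b (prev r)) (b r)) (alt r)) ⟩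
      b (prev r) xor true              ≡⟨ Bool.xor-comm _ true ⟩
      not (b (prev r))                 ≡⟨ cong not eq ⟩
      not (b p₀ xor odd (prev r))      ≡⟨ Bool.not-distribʳ-xor (b p₀) _ ⟩
      b p₀ xor not (odd (prev r))      ∎
      where open ≡-Reasoning
    bits₀ = sym (Bool.xor-identityʳ (b p₀))
    bits₁ = flipBit p₁ bits₀
    bits₂ = flipBit p₂ bits₁
    bits₃ = flipBit p₃ bits₂
    bits₄ = flipBit p₄ bits₃
    bits₅ = flipBit p₅ bits₄
    bits : AlternatingBits M h∈S
    bits p₀ = bits₀
    bits p₁ = bits₁
    bits p₂ = bits₂
    bits p₃ = bits₃
    bits p₄ = bits₄
    bits p₅ = bits₅

  AlternatingBits⇒AlternatesAt : ∀ {M h} (h∈S : h ∈ S) → AlternatingBits M h∈S → ∀ r → AlternatesAt M h∈S r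
  AlternatingBits⇒AlternatesAt {M} h∈S bits r = begin
    bit M (indexOf h∈S r) xor bit M (indexOf h∈S (prev r))  ≡⟨ cong₂ _xor_ (bits r) (bits (prev r)) ⟩
    (b₀ xor odd r) xor (b₀ xor odd (prev r))                ≡⟨ xor-interchange b₀ (odd r) b₀ (odd (prev r)) ⟩
    (b₀ xor b₀) xor (odd r xor odd (prev r))                ≡⟨ cong₂ _xor_ (Bool.xor-same b₀) (odd-xor-prev r) ⟩
    true                                                    ∎
    where
    open ≡-Reasoning
    b₀ = bit M (indexOf h∈S p₀)

  EdgeStatus : ES → Edge → Bool → Set
  EdgeStatus M e true = _∈E_ S e M
  EdgeStatus M e false = ¬ _∈E_ S e M

  EdgeStatus⇒bit : ∀ M k b → EdgeStatus M (edgeOf k) b → bit M k ≡ b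
  EdgeStatus⇒bit M k true e∈M = ∈E⇒bit M k refl e∈M
  EdgeStatus⇒bit M k false e∉M with bit M k in eq
  ... | true = ⊥-elim (e∉M (bit⇒∈E M k eq))
  ... | false = refl

  bit⇒EdgeStatus : ∀ M k b → bit M k ≡ b → EdgeStatus M (edgeOf k) b
  bit⇒EdgeStatus M k true eq = bit⇒∈E M k eq
  bit⇒EdgeStatus M k false eq e∈M with () ← trans (sym eq) (∈E⇒bit M k refl e∈M)

  module _ {M : ES} {h : Cell} where

    AltFrom⇒EdgeStatus : ∀ b → AltFrom S M b (cellEdges h) → ∀ q → EdgeStatus M (edgeAt h q) (b xor odd q)
    AltFrom⇒EdgeStatus true  (s₀ , s₁ , s₂ , s₃ , s₄ , s₅ , _) = λ { p₀ → s₀ ; p₁ → s₁ ; p₂ → s₂ ; p₃ → s₃ ; p₄ → s₄ ; p₅ → s₅ }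
    AltFrom⇒EdgeStatus false (s₀ , s₁ , s₂ , s₃ , s₄ , s₅ , _) = λ { p₀ → s₀ ; p₁ → s₁ ; p₂ → s₂ ; p₃ → s₃ ; p₄ → s₄ ; p₅ → s₅ }

    EdgeStatus⇒AltFrom : ∀ b → (∀ q → EdgeStatus M (edgeAt h q) (b xor odd q)) → AltFrom S M b (cellEdges h)
    EdgeStatus⇒AltFrom true  s = s p₀ , s p₁ , s p₂ , s p₃ , s p₄ , s p₅ , tt
    EdgeStatus⇒AltFrom false s = s p₀ , s p₁ , s p₂ , s p₃ , s p₄ , s p₅ , tt

    AltFrom⇒AlternatingBits : ∀ (h∈S : h ∈ S) b → AltFrom S M b (cellEdges h) → AlternatingBits M h∈S
    AltFrom⇒AlternatingBits h∈S b alt q = trans (bit≡ q) (cong (_xor odd q) (sym (trans (bit≡ p₀) (Bool.xor-identityʳ b))))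
      where
      bit≡ : ∀ q → bit M (indexOf h∈S q) ≡ b xor odd q
      bit≡ q = EdgeStatus⇒bit M _ _ (subst (λ e → EdgeStatus M e (b xor odd q)) (sym (edgeOf-indexOf h∈S q))
        (AltFrom⇒EdgeStatus b alt q))

    Alternating⇒AlternatingBits : ∀ (h∈S : h ∈ S) → Alternating S M h → AlternatingBits M h∈S
    Alternating⇒AlternatingBits h∈S (inj₁ alt) = AltFrom⇒AlternatingBits h∈S true alt
    Alternating⇒AlternatingBits h∈S (inj₂ alt) = AltFrom⇒AlternatingBits h∈S false alt

    AltFrom⇒Alternating : ∀ b → AltFrom S M b (cellEdges h) → Alternating S M h
    AltFrom⇒Alternating true = inj₁
    AltFrom⇒Alternating false = inj₂

    AlternatingBits⇒Alternating : ∀ (h∈S : h ∈ S) → AlternatingBits M h∈S → Alternating S M h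
    AlternatingBits⇒Alternating h∈S bits = AltFrom⇒Alternating b₀ (EdgeStatus⇒AltFrom b₀ status)
      where
      b₀ = bit M (indexOf h∈S p₀)
      status : ∀ q → EdgeStatus M (edgeAt h q) (b₀ xor odd q)
      status q = subst (λ e → EdgeStatus M e (b₀ xor odd q)) (edgeOf-indexOf h∈S q) (bit⇒EdgeStatus M _ _ (bits q))

  matchedEdgeAt : ∀ {M h} (h∈S : h ∈ S) → (∀ r → AlternatesAt M h∈S r) →
    ∀ r → Σ[ p ∈ Pos ] ((p ≡ r ⊎ p ≡ prev r) × bit M (indexOf h∈S p) ≡ true)
  matchedEdgeAt {M} h∈S alt r with bit M (indexOf h∈S r) in eq
  ... | true = r , inj₁ refl , eq
  ... | false = prev r , inj₂ refl , subst (λ b → b xor bit M (indexOf h∈S (prev r)) ≡ true) eq (alt r)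

  AlternatesAt⇒matched-unique : ∀ {M h} (h∈S : h ∈ S) r → AlternatesAt M h∈S r → ∀ q q′ →
    (q ≡ r ⊎ q ≡ prev r) → (q′ ≡ r ⊎ q′ ≡ prev r) →
    bit M (indexOf h∈S q) ≡ true → bit M (indexOf h∈S q′) ≡ true → q ≡ q′
  AlternatesAt⇒matched-unique h∈S r alt q q′ (inj₁ refl) (inj₁ refl) _ _ = refl
  AlternatesAt⇒matched-unique h∈S r alt q q′ (inj₂ refl) (inj₂ refl) _ _ = refl
  AlternatesAt⇒matched-unique h∈S r alt q q′ (inj₁ refl) (inj₂ refl) q∈M q′∈M =
    ⊥-elim (Bool.not-¬ {true} refl (trans (sym alt) (cong₂ _xor_ q∈M q′∈M)))
  AlternatesAt⇒matched-unique h∈S r alt q q′ (inj₂ refl) (inj₁ refl) q∈M q′∈M =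
    ⊥-elim (Bool.not-¬ {true} refl (trans (sym alt) (cong₂ _xor_ q′∈M q∈M)))

  MatchedOnce : ES → Vertex → Set
  MatchedOnce M v = Σ[ e ∈ Edge ] (_∈E_ S e M × Incident v e × (∀ e′ → _∈E_ S e′ M → Incident v e′ → e′ ≡ e))

  alternating⇒MatchedOnce : ∀ {M c} (c∈S : c ∈ S) → AlternatingBits M c∈S →
    (∀ k r → bit M k ≡ true → Incident (vertexAt c r) (edgeOf k) → inCell k c ≡ true) →
    ∀ r → MatchedOnce M (vertexAt c r)
  alternating⇒MatchedOnce {M} {c} c∈S bits closed r =
    edgeAt c p , (indexOf c∈S p , edgeOf-indexOf c∈S p , p∈M) , edgeAt-incident c r p p-adj , unique
    where
    alt = AlternatingBits⇒AlternatesAt {M} c∈S bits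
    matched = matchedEdgeAt {M} c∈S alt r
    p = proj₁ matched
    p-adj = proj₁ (proj₂ matched)
    p∈M = proj₂ (proj₂ matched)
    unique : ∀ e′ → _∈E_ S e′ M → Incident (vertexAt c r) e′ → e′ ≡ edgeAt c p
    unique e′ (k , refl , k∈M) inc = trans (sym q≡k) (cong (edgeAt c) q≡p)
      where
      position = inCell⇒edgeAt k c (closed k r k∈M inc)
      q = proj₁ position
      q≡k = proj₂ position
      q∈M : bit M (indexOf c∈S q) ≡ true
      q∈M = subst (λ k′ → bit M k′ ≡ true) (sym (indexOf-unique c∈S q k (sym q≡k))) k∈M
      q≡p : q ≡ p
      q≡p = AlternatesAt⇒matched-unique {M} c∈S r (alt r) q p
        (incident⇒adjacentPos c r q (subst (Incident (vertexAt c r)) (sym q≡k) inc)) p-adj q∈M p∈M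

  matchedEdge∈hexagon : ∀ {M c} (c∈S : c ∈ S) → IsPM S M → AlternatingBits M c∈S →
    ∀ r k → bit M k ≡ true → Incident (vertexAt c r) (edgeOf k) → inCell k c ≡ true
  matchedEdge∈hexagon {M} {c} c∈S pm bits r k k∈M inc = subst (λ k′ → inCell k′ c ≡ true) (sym k≡p) (inCell-indexOf c∈S p)
    where
    matched = matchedEdgeAt {M} c∈S (AlternatingBits⇒AlternatesAt {M} c∈S bits) r
    p = proj₁ matched
    k≡p : k ≡ indexOf c∈S p
    k≡p = IsPM-unique-index {M} pm k (indexOf c∈S p) k∈M (proj₂ (proj₂ matched)) inc
      (incident-indexOf c∈S r p (proj₁ (proj₂ matched)))

  -- The edge of M at a common vertex lies on both hexagons, so flipping h changes exactly
  -- one of the two edges of h′ there, destroying the alternation of h′.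
  flip-preserves-alternation⇒vertex-disjoint : ∀ {M M′ h h′} → IsPM S M → (h∈S : h ∈ S) (h′∈S : h′ ∈ S) →
    (∀ r → AlternatesAt M h∈S r) → (∀ r → AlternatesAt M h′∈S r) →
    HexFlip M M′ h → (∀ r → AlternatesAt M′ h′∈S r) → h′ ≢ h → ∀ r r′ → vertexAt h r ≢ vertexAt h′ r′
  flip-preserves-alternation⇒vertex-disjoint {M} {M′} {h} {h′} pm h∈S h′∈S alt alt′ flip alt′-flipped h′≢h r r′ same =
    h′≢h (sym (inCell-twice⇒≡ h′∈S h r′ (prev r′) (λ e → prev≢ r′ (sym e)) s≡true t≡true))
    where
    matched = matchedEdgeAt {M} h∈S alt r
    matched′ = matchedEdgeAt {M} h′∈S alt′ r′
    p = proj₁ matched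
    p′ = proj₁ matched′
    shared : indexOf h′∈S p′ ≡ indexOf h∈S p
    shared = IsPM-unique-index {M} pm _ _ (proj₂ (proj₂ matched′)) (proj₂ (proj₂ matched))
      (subst (λ v → Incident v (edgeOf (indexOf h′∈S p′))) (sym same) (incident-indexOf h′∈S r′ p′ (proj₁ (proj₂ matched′))))
      (incident-indexOf h∈S r p (proj₁ (proj₂ matched)))
    p′-in-h : inCell (indexOf h′∈S p′) h ≡ true
    p′-in-h = subst (λ k → inCell k h ≡ true) (sym shared) (inCell-indexOf h∈S p)
    s = inCell (indexOf h′∈S r′) h
    t = inCell (indexOf h′∈S (prev r′)) h
    s≡t : s ≡ t
    s≡t = complementary-flip (bit M (indexOf h′∈S r′)) (bit M (indexOf h′∈S (prev r′))) s t (alt′ r′)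
      (trans (sym (cong₂ _xor_ (HexFlip-target flip _) (HexFlip-target flip _))) (alt′-flipped r′))
    s≡true : s ≡ true
    s≡true with proj₁ (proj₂ matched′)
    ... | inj₁ p′≡r′ = subst (λ q → inCell (indexOf h′∈S q) h ≡ true) p′≡r′ p′-in-h
    ... | inj₂ p′≡prev = trans s≡t (subst (λ q → inCell (indexOf h′∈S q) h ≡ true) p′≡prev p′-in-h)
    t≡true : t ≡ true
    t≡true = trans (sym s≡t) s≡true


module ClarCovers (S : List Cell) where

  open Geometry
  open Edges S
  open Resonance S
  open Alternation S

  module _ {F : ES} where

    HexComp-edge : ∀ {c} (hc : HexComp S F c) p → bit F (indexOf (proj₁ hc) p) ≡ true
    HexComp-edge {c} (c∈S , edges∈F , _) p = ∈E⇒bit F _ (edgeOf-indexOf c∈S p) (edges∈F (edgeAt c p) (edgeAt∈ c p))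

    HexComp-closed : ∀ {c} → HexComp S F c → ∀ k r → bit F k ≡ true →
      Incident (vertexAt c r) (edgeOf k) → inCell k c ≡ true
    HexComp-closed {c} (_ , _ , closed) k r k∈F inc =
      inCell-true⁺ k c (closed _ (bit⇒∈E F k k∈F) (vertexAt c r) (vertexAt∈ c r) inc)

    HexComp-disjoint : ∀ {c c′} → HexComp S F c → HexComp S F c′ → ∀ r r′ →
      vertexAt c r ≡ vertexAt c′ r′ → c ≡ c′
    HexComp-disjoint {c} {c′} hc hc′@(c′∈S , _) r r′ same =
      inCell-twice⇒≡ c′∈S c r′ (prev r′) (λ e → prev≢ r′ (sym e)) (in-c r′ (inj₁ refl)) (in-c (prev r′) (inj₂ refl))
      where
      in-c : ∀ p → p ≡ r′ ⊎ p ≡ prev r′ → inCell (indexOf c′∈S p) c ≡ true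
      in-c p adj = HexComp-closed hc _ r (HexComp-edge hc′ p)
        (subst (λ v → Incident v (edgeOf (indexOf c′∈S p))) (sym same) (incident-indexOf c′∈S r′ p adj))

    EdgeComp∉cellEdges : ∀ {c e} → EdgeComp S F e → HexComp S F c → ¬ e ∈ cellEdges c
    EdgeComp∉cellEdges {c} (_ , isolated) hc@(c∈S , edges∈F , _) e∈c with ∈⇒edgeAt c e∈c
    ... | q , refl = prev≢ q (edgeAt-injective c _ _
      (isolated _ (edges∈F _ (edgeAt∈ c (prev q)))
        (incident-endpoint (edgeAt-incidentʳ c q) (edgeAt-incidentˡ c q))))

  ComponentAt : ES → Vertex → Set
  ComponentAt F v = (Σ[ c ∈ Cell ] (HexComp S F c × v ∈ cellVertices c)) ⊎ (Σ[ e ∈ Edge ] (EdgeComp S F e × Incident v e))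

  module _ {F M : ES} (cover : ClarCover S F) (pm : IsPM S M) (M∈fF : fC S F M) where

    fC⇒AlternatingBits : ∀ {c} (hc : HexComp S F c) → AlternatingBits M (proj₁ hc)
    fC⇒AlternatingBits {c} hc = Alternating⇒AlternatingBits {M} (proj₁ hc) (proj₁ M∈fF c hc)

    fC⊆cover : ∀ k → bit M k ≡ true → bit F k ≡ true
    fC⊆cover k k∈M = via (cover v (incident⇒∈VH k (inj₁ refl)))
      where
      v = proj₁ (edgeOf k)
      via : ComponentAt F v → bit F k ≡ true
      via (inj₁ (c , hc , v∈c)) = ∈E⇒bit F k (sym (proj₂ position)) (proj₁ (proj₂ hc) _ (edgeAt∈ c (proj₁ position)))
        where
        r = ∈⇒vertexAt c v∈c
        position = inCell⇒edgeAt k c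
          (matchedEdge∈hexagon {M} (proj₁ hc) pm (fC⇒AlternatingBits hc) (proj₁ r) k k∈M (inj₁ (sym (proj₂ r))))
      via (inj₂ (e , ec , inc)) = ∈E⇒bit F k
        (IsPM-unique {M} pm (incident⇒∈VH k (inj₁ refl)) (bit⇒∈E M k k∈M) (inj₁ refl) (proj₂ M∈fF e ec) inc) (proj₁ ec)

    -- Off the hexagons of F, an edge of F is a single-edge component, hence in M.
    fC-agrees-off-hexagons : ∀ k → (∀ c → HexComp S F c → inCell k c ≡ false) → bit M k ≡ bit F k
    fC-agrees-off-hexagons k off = Bool.⇔→≡ (mk⇔ (fC⊆cover k) cover⊆fC)
      where
      v = proj₁ (edgeOf k)
      cover⊆fC : bit F k ≡ true → bit M k ≡ true
      cover⊆fC k∈F = via (cover v (incident⇒∈VH k (inj₁ refl)))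
        where
        via : ComponentAt F v → bit M k ≡ true
        via (inj₁ (c , hc , v∈c)) = ⊥-elim (Bool.not-¬ (off c hc)
          (HexComp-closed {F} hc k (proj₁ r) k∈F (inj₁ (sym (proj₂ r)))))
          where r = ∈⇒vertexAt c v∈c
        via (inj₂ (e , ec , inc)) =
          ∈E⇒bit M k (proj₂ ec _ (bit⇒∈E F k k∈F) (incident-endpoint inc (inj₁ refl))) (proj₂ M∈fF e ec)

  fC-determined : ∀ {F M M′} → ClarCover S F → (L : List Cell) → (∀ c → c ∈ L ⇔ HexComp S F c) →
    IsPM S M → fC S F M → IsPM S M′ → fC S F M′ →
    (∀ {c} (hc : HexComp S F c) → bit M (indexOf (proj₁ hc) p₀) ≡ bit M′ (indexOf (proj₁ hc) p₀)) → M ≡ M′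
  fC-determined {F} {M} {M′} cover L L-hexagons pm M∈fF pm′ M′∈fF same-p₀ =
    Pointwise-≡⇒≡ (ext λ k → by-case k (any? (λ c → inCell k c Bool.≟ true) L))
    where
    by-case : ∀ k → Dec (Any (λ c → inCell k c ≡ true) L) → bit M k ≡ bit M′ k
    by-case k (yes k∈L) = subst (λ k′ → bit M k′ ≡ bit M′ k′) (indexOf-unique c∈S q k (sym q≡k)) (begin
      bit M (indexOf c∈S q)                ≡⟨ fC⇒AlternatingBits {F} {M} cover pm M∈fF hc q ⟩
      bit M (indexOf c∈S p₀) xor odd q     ≡⟨ cong (_xor odd q) (same-p₀ hc) ⟩
      bit M′ (indexOf c∈S p₀) xor odd q    ≡⟨ sym (fC⇒AlternatingBits {F} {M′} cover pm′ M′∈fF hc q) ⟩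
      bit M′ (indexOf c∈S q)               ∎)
      where
      open ≡-Reasoning
      found = find k∈L
      c = proj₁ found
      hc = Equivalence.to (L-hexagons c) (proj₁ (proj₂ found))
      c∈S = proj₁ hc
      position = inCell⇒edgeAt k c (proj₂ (proj₂ found))
      q = proj₁ position
      q≡k = proj₂ position
    by-case k (no k∉L) = begin
      bit M k    ≡⟨ fC-agrees-off-hexagons {F} {M} cover pm M∈fF k off ⟩
      bit F k    ≡⟨ sym (fC-agrees-off-hexagons {F} {M′} cover pm′ M′∈fF k off) ⟩
      bit M′ k   ∎
      where
      open ≡-Reasoning
      off : ∀ c → HexComp S F c → inCell k c ≡ false
      off c hc = Bool.¬-not (λ k∈c → k∉L (lose (Equivalence.from (L-hexagons c) hc) k∈c))


module Toggle (S : List Cell) where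

  open Geometry
  open Edges S
  open Resonance S
  open XorSums
  open Cube

  EdgeDisjoint : ∀ {n} → (Fin n → Cell) → Set
  EdgeDisjoint h = ∀ k i j → j ≢ i → inCell k (h i) ≡ true → inCell k (h j) ≡ false

  vertexDisjoint⇒EdgeDisjoint : ∀ {n} (h : Fin n → Cell) →
    (∀ i j → j ≢ i → ∀ r r′ → vertexAt (h i) r ≢ vertexAt (h j) r′) → EdgeDisjoint h
  vertexDisjoint⇒EdgeDisjoint h disjoint k i j j≢i k∈hᵢ = Bool.¬-not λ k∈hⱼ →
    disjoint i j j≢i (start (proj₁ (in-h i k∈hᵢ))) (start (proj₁ (in-h j k∈hⱼ)))
      (cong proj₁ (trans (endpoints i k∈hᵢ) (sym (endpoints j k∈hⱼ))))
    where
    in-h : ∀ l → inCell k (h l) ≡ true → Σ[ p ∈ Pos ] edgeAt (h l) p ≡ edgeOf k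
    in-h l k∈hₗ = inCell⇒edgeAt k (h l) k∈hₗ
    endpoints : ∀ l (k∈hₗ : inCell k (h l) ≡ true) →
      (vertexAt (h l) (start (proj₁ (in-h l k∈hₗ))) , vertexAt (h l) (end (proj₁ (in-h l k∈hₗ)))) ≡ edgeOf k
    endpoints l k∈hₗ = trans (sym (edgeAt-endpoints (h l) (proj₁ (in-h l k∈hₗ)))) (proj₂ (in-h l k∈hₗ))

  hexagon-edge-induction : ∀ {n} (h : Fin n → Cell) (h∈S : ∀ i → h i ∈ S) (P : Fin (nE S) → Set) →
    (∀ i q → P (indexOf (h∈S i) q)) → (∀ k → (∀ i → inCell k (h i) ≡ false) → P k) → ∀ k → P k
  hexagon-edge-induction {n} h h∈S P on off k = by-case (Fin.any? (λ i → inCell k (h i) Bool.≟ true))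
    where
    by-case : Dec (Σ[ i ∈ Fin n ] inCell k (h i) ≡ true) → P k
    by-case (yes (i , k∈hᵢ)) = subst P (indexOf-unique (h∈S i) _ k (sym (proj₂ position))) (on i (proj₁ position))
      where position = inCell⇒edgeAt k (h i) k∈hᵢ
    by-case (no none) = off k (λ i → Bool.¬-not (λ k∈hᵢ → none (i , k∈hᵢ)))

  flip-QAdj : ∀ {n} (u : Vec Bool n) i → QAdj S u (flip u i)
  flip-QAdj u i = i , (λ eq → Bool.not-¬ refl (trans eq (lookup-flip u i))) , λ j j≢i → sym (lookup-flip′ u i j j≢i)

  toggle : ∀ {n} → ES → (Fin n → Cell) → Vec Bool n → ES
  toggle M h u = tabulate λ k → bit M k xor sum (λ i → lookup u i ∧ inCell k (h i))

  module _ {n} (M : ES) (h : Fin n → Cell) where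

    bit-toggle : ∀ u k → bit (toggle M h u) k ≡ bit M k xor sum (λ i → lookup u i ∧ inCell k (h i))
    bit-toggle u k = lookup∘tabulate _ k

    toggle-xor : ∀ u v k →
      bit (toggle M h u) k xor bit (toggle M h v) k ≡ sum (λ i → (lookup u i xor lookup v i) ∧ inCell k (h i))
    toggle-xor u v k = begin
      bit (toggle M h u) k xor bit (toggle M h v) k  ≡⟨ cong₂ _xor_ (bit-toggle u k) (bit-toggle v k) ⟩
      (m xor σ u) xor (m xor σ v)                    ≡⟨ xor-interchange m (σ u) m (σ v) ⟩
      (m xor m) xor (σ u xor σ v)                    ≡⟨ cong (_xor (σ u xor σ v)) (Bool.xor-same m) ⟩
      σ u xor σ v                                    ≡⟨ sum-∧-xor (lookup u) (lookup v) (λ i → inCell k (h i)) ⟩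
      sum (λ i → (lookup u i xor lookup v i) ∧ inCell k (h i)) ∎
      where
      open ≡-Reasoning
      m = bit M k
      σ : Vec Bool n → Bool
      σ w = sum (λ i → lookup w i ∧ inCell k (h i))

    toggle-off : ∀ u k → (∀ i → inCell k (h i) ≡ false) → bit (toggle M h u) k ≡ bit M k
    toggle-off u k off = trans (bit-toggle u k) (trans (cong (bit M k xor_)
      (sum-false _ (λ i → trans (cong (lookup u i ∧_) (off i)) (Bool.∧-zeroʳ _)))) (Bool.xor-identityʳ _))

    toggle-on : EdgeDisjoint h → ∀ u k i → inCell k (h i) ≡ true → bit (toggle M h u) k ≡ bit M k xor lookup u i
    toggle-on disjoint u k i k∈hᵢ = trans (bit-toggle u k) (cong (bit M k xor_) (trans
      (sum-single _ i (λ j j≢i → trans (cong (lookup u j ∧_) (disjoint k i j j≢i k∈hᵢ)) (Bool.∧-zeroʳ _)))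
      (trans (cong (lookup u i ∧_) k∈hᵢ) (Bool.∧-identityʳ _))))

    toggle-flip : ∀ u i → h i ∈ S → HexFlip (toggle M h u) (toggle M h (flip u i)) (h i)
    toggle-flip u i hᵢ∈S = hᵢ∈S , λ k → trans (toggle-xor u (flip u i) k) (trans
      (sum-single _ i (λ j j≢i → trans (cong (λ b → (lookup u j xor b) ∧ inCell k (h j)) (lookup-flip′ u i j j≢i))
                                       (cong (_∧ inCell k (h j)) (Bool.xor-same (lookup u j)))))
      (cong (_∧ inCell k (h i)) (trans (cong (lookup u i xor_) (lookup-flip u i)) (Bool.xor-inverseʳ (lookup u i)))))

    QAdj⇒flip : ∀ {u v : Vec Bool n} → QAdj S u v → Σ[ i ∈ Fin n ] v ≡ flip u i
    QAdj⇒flip {u} {v} (i , uᵢ≢vᵢ , others) = i , Pointwise-≡⇒≡ (ext same)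
      where
      same : ∀ j → lookup v j ≡ lookup (flip u i) j
      same j with j Fin.≟ i
      ... | yes refl = trans (Bool.¬-not (uᵢ≢vᵢ ∘ sym)) (sym (lookup-flip u i))
      ... | no j≢i = trans (sym (others j j≢i)) (sym (lookup-flip′ u i j j≢i))

    -- c contains two edges of each h i with u i ≢ v i, so there is exactly one such i.
    toggle-HexFlip⇒QAdj : EdgeDisjoint h → (∀ i j → h i ≡ h j → i ≡ j) → (∀ i → h i ∈ S) →
      ∀ u v {c} → HexFlip (toggle M h u) (toggle M h v) c → QAdj S u v
    toggle-HexFlip⇒QAdj disjoint h-injective h∈S u v {c} (c∈S , flips) = conclude (Fin.any? (λ i → d i Bool.≟ true))
      where
      d : Fin n → Bool
      d j = lookup u j xor lookup v j
      difference : ∀ k → inCell k c ≡ sum (λ j → d j ∧ inCell k (h j))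
      difference k = trans (sym (flips k)) (toggle-xor u v k)
      c≡h : ∀ j → d j ≡ true → c ≡ h j
      c≡h j dⱼ = inCell-twice⇒≡ (h∈S j) c p₀ p₁ (λ ()) (edge-in-c p₀) (edge-in-c p₁)
        where
        edge-in-c : ∀ q → inCell (indexOf (h∈S j) q) c ≡ true
        edge-in-c q = trans (difference k) (trans
          (sum-single _ j (λ j′ j′≢j → trans (cong (d j′ ∧_) (disjoint k j j′ j′≢j (inCell-indexOf (h∈S j) q))) (Bool.∧-zeroʳ _)))
          (cong₂ _∧_ dⱼ (inCell-indexOf (h∈S j) q)))
          where k = indexOf (h∈S j) q
      conclude : Dec (Σ[ i ∈ Fin n ] d i ≡ true) → QAdj S u v
      conclude (yes (i , dᵢ)) = i , xor≡true⇒≢ _ _ dᵢ , λ j j≢i →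
        xor≡false⇒≡ _ _ (Bool.¬-not (λ dⱼ → j≢i (h-injective j i (trans (sym (c≡h j dⱼ)) (c≡h i dᵢ)))))
      conclude (no none) = ⊥-elim (Bool.not-¬ {true} refl (begin
        true                                        ≡⟨ sym (inCell-indexOf c∈S p₀) ⟩
        inCell k₀ c                                 ≡⟨ difference k₀ ⟩
        sum (λ j → d j ∧ inCell k₀ (h j))           ≡⟨ sum-false _ (λ j → cong (_∧ inCell k₀ (h j)) (Bool.¬-not (λ dⱼ → none (j , dⱼ)))) ⟩
        false                                       ∎))
        where
        open ≡-Reasoning
        k₀ = indexOf c∈S p₀


module CoverToCube (S : List Cell) (F : ESet S) (cover : ClarCover S F)
  (L : List Cell) (L-unique : Unique L) (L-hexagons : ∀ h → h ∈ L ⇔ HexComp S F h) where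

  open Geometry
  open Edges S
  open Resonance S
  open Alternation S
  open ClarCovers S
  open Toggle S
  open XorSums
  open Cube

  n : ℕ
  n = List.length L

  g : Fin n → Cell
  g = List.lookup L

  g-HexComp : ∀ i → HexComp S F (g i)
  g-HexComp i = Equivalence.to (L-hexagons (g i)) (∈-lookup i)

  g∈S : ∀ i → g i ∈ S
  g∈S i = proj₁ (g-HexComp i)

  HexComp⇒g : ∀ {c} → HexComp S F c → Σ[ i ∈ Fin n ] g i ≡ c
  HexComp⇒g {c} hc = index c∈L , sym (lookup-index c∈L)
    where c∈L = Equivalence.from (L-hexagons c) hc

  g-injective : ∀ i j → g i ≡ g j → i ≡ j
  g-injective = Unique⇒lookup-injective L-unique

  g-disjoint : EdgeDisjoint g
  g-disjoint = vertexDisjoint⇒EdgeDisjoint g λ i j j≢i r r′ same →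
    j≢i (g-injective j i (HexComp-disjoint {F} (g-HexComp j) (g-HexComp i) r′ r (sym same)))

  -- F without the odd-position edges of its hexagons
  M₀ : ES
  M₀ = tabulate λ k → bit F k xor sum (λ i → inCell k (g i) ∧ oddIn k (g i))

  bit-M₀-on : ∀ i q → bit M₀ (indexOf (g∈S i) q) ≡ not (odd q)
  bit-M₀-on i q = begin
    bit M₀ k                                              ≡⟨ lookup∘tabulate _ k ⟩
    bit F k xor sum (λ j → inCell k (g j) ∧ oddIn k (g j)) ≡⟨ cong₂ _xor_ (HexComp-edge {F} (g-HexComp i) q) only-gᵢ ⟩
    true xor odd q                                        ∎
    where
    open ≡-Reasoning
    k = indexOf (g∈S i) q
    only-gᵢ : sum (λ j → inCell k (g j) ∧ oddIn k (g j)) ≡ odd q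
    only-gᵢ = trans (sum-single _ i (λ j j≢i → cong (_∧ oddIn k (g j)) (g-disjoint k i j j≢i (inCell-indexOf (g∈S i) q))))
                    (cong₂ _∧_ (inCell-indexOf (g∈S i) q) (oddIn-indexOf (g∈S i) q))

  bit-M₀-off : ∀ k → (∀ i → inCell k (g i) ≡ false) → bit M₀ k ≡ bit F k
  bit-M₀-off k off = trans (lookup∘tabulate _ k) (trans
    (cong (bit F k xor_) (sum-false _ (λ i → cong (_∧ oddIn k (g i)) (off i)))) (Bool.xor-identityʳ _))

  ψ : Vec Bool n → ES
  ψ = toggle M₀ g

  ψ-on : ∀ u i q → bit (ψ u) (indexOf (g∈S i) q) ≡ not (odd q) xor lookup u i
  ψ-on u i q = trans (toggle-on M₀ g g-disjoint u _ i (inCell-indexOf (g∈S i) q)) (cong (_xor lookup u i) (bit-M₀-on i q))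

  ψ-off : ∀ u k → (∀ i → inCell k (g i) ≡ false) → bit (ψ u) k ≡ bit F k
  ψ-off u k off = trans (toggle-off M₀ g u k off) (bit-M₀-off k off)

  ψ⊆F : ∀ u k → bit (ψ u) k ≡ true → bit F k ≡ true
  ψ⊆F u = hexagon-edge-induction g g∈S (λ k → bit (ψ u) k ≡ true → bit F k ≡ true)
    (λ i q _ → HexComp-edge {F} (g-HexComp i) q) (λ k off k∈ψ → trans (sym (ψ-off u k off)) k∈ψ)

  ψ-AlternatingBits : ∀ u i → AlternatingBits (ψ u) (g∈S i)
  ψ-AlternatingBits u i q = begin
    bit (ψ u) (indexOf (g∈S i) q)  ≡⟨ ψ-on u i q ⟩
    not (odd q) xor uᵢ             ≡⟨ sym (Bool.not-distribˡ-xor (odd q) uᵢ) ⟩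
    not (odd q xor uᵢ)             ≡⟨ cong not (Bool.xor-comm (odd q) uᵢ) ⟩
    not (uᵢ xor odd q)             ≡⟨ Bool.not-distribˡ-xor uᵢ (odd q) ⟩
    not uᵢ xor odd q               ≡⟨ cong (_xor odd q) (sym (ψ-on u i p₀)) ⟩
    bit (ψ u) (indexOf (g∈S i) p₀) xor odd q ∎
    where
    open ≡-Reasoning
    uᵢ = lookup u i

  ψ∈fF : ∀ u → fC S F (ψ u)
  ψ∈fF u = hexagons , single-edges
    where
    hexagons : ∀ c → HexComp S F c → Alternating S (ψ u) c
    hexagons c hc = subst (Alternating S (ψ u)) (proj₂ (HexComp⇒g hc))
      (AlternatingBits⇒Alternating {ψ u} (g∈S _) (ψ-AlternatingBits u (proj₁ (HexComp⇒g hc))))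
    single-edges : ∀ e → EdgeComp S F e → _∈E_ S e (ψ u)
    single-edges e ec@((k , refl , k∈F) , _) = k , refl , trans (ψ-off u k off) k∈F
      where
      off : ∀ i → inCell k (g i) ≡ false
      off i = inCell-false⁺ k (g i) (EdgeComp∉cellEdges {F} ec (g-HexComp i))

  ψ-IsPM : ∀ u → IsPM S (ψ u)
  ψ-IsPM u v v∈ = via (cover v v∈)
    where
    via : ComponentAt F v → MatchedOnce (ψ u) v
    via (inj₂ (e , ec , inc)) = e , proj₂ (ψ∈fF u) e ec , inc , λ e′ (k , k≡ , k∈ψ) inc′ →
      proj₂ ec e′ (k , k≡ , ψ⊆F u k k∈ψ) (incident-endpoint inc inc′)
    via (inj₁ (c , hc , v∈c)) = subst (MatchedOnce (ψ u)) (trans (cong (λ c′ → vertexAt c′ r) gᵢ≡c) r≡v)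
      (alternating⇒MatchedOnce {ψ u} (g∈S i) (ψ-AlternatingBits u i)
        (λ k r′ k∈ψ → HexComp-closed {F} (g-HexComp i) k r′ (ψ⊆F u k k∈ψ)) r)
      where
      i = proj₁ (HexComp⇒g hc)
      gᵢ≡c = proj₂ (HexComp⇒g hc)
      r = proj₁ (∈⇒vertexAt c v∈c)
      r≡v = proj₂ (∈⇒vertexAt c v∈c)

  ψ-injective : ∀ u v → ψ u ≡ ψ v → u ≡ v
  ψ-injective u v eq = Pointwise-≡⇒≡ (ext λ i → Bool.not-injective (begin
    not (lookup u i)                 ≡⟨ sym (ψ-on u i p₀) ⟩
    bit (ψ u) (indexOf (g∈S i) p₀)   ≡⟨ cong (λ M → bit M (indexOf (g∈S i) p₀)) eq ⟩
    bit (ψ v) (indexOf (g∈S i) p₀)   ≡⟨ ψ-on v i p₀ ⟩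
    not (lookup v i)                 ∎))
    where open ≡-Reasoning

  ψ-surjective : ∀ M → IsPM S M → fC S F M → Σ[ u ∈ Vec Bool n ] ψ u ≡ M
  ψ-surjective M pm M∈fF = u , fC-determined {F} cover L L-hexagons (ψ-IsPM u) (ψ∈fF u) pm M∈fF same-p₀
    where
    u = tabulate (λ i → not (bit M (indexOf (g∈S i) p₀)))
    same-p₀ : ∀ {c} (hc : HexComp S F c) → bit (ψ u) (indexOf (proj₁ hc) p₀) ≡ bit M (indexOf (proj₁ hc) p₀)
    same-p₀ hc = subst (λ k → bit (ψ u) k ≡ bit M k) (indexOf-cong (g∈S i) (proj₁ hc) gᵢ≡c p₀) (begin
      bit (ψ u) (indexOf (g∈S i) p₀)           ≡⟨ ψ-on u i p₀ ⟩
      not (lookup u i)                         ≡⟨ cong not (lookup∘tabulate _ i) ⟩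
      not (not (bit M (indexOf (g∈S i) p₀)))   ≡⟨ Bool.not-involutive _ ⟩
      bit M (indexOf (g∈S i) p₀)               ∎)
      where
      open ≡-Reasoning
      i = proj₁ (HexComp⇒g hc)
      gᵢ≡c = proj₂ (HexComp⇒g hc)

  ψ-RAdj⇔QAdj : ∀ u v → RAdj S (ψ u) (ψ v) ⇔ QAdj S u v
  ψ-RAdj⇔QAdj u v = mk⇔
    (λ adj → toggle-HexFlip⇒QAdj M₀ g g-disjoint g-injective g∈S u v (proj₂ (RAdj⇒HexFlip adj)))
    (λ u~v → flip⇒RAdj (QAdj⇒flip M₀ g u~v))
    where
    flip⇒RAdj : (Σ[ i ∈ Fin n ] v ≡ flip u i) → RAdj S (ψ u) (ψ v)
    flip⇒RAdj (i , refl) = HexFlip⇒RAdj (toggle-flip M₀ g u i (g∈S i))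

  ψ-cube : InducesCube S n (fC S F)
  ψ-cube = ψ , (λ u → ψ-IsPM u , ψ∈fF u) , ψ-injective , ψ-surjective , ψ-RAdj⇔QAdj

  cover⊆⋃fC : ∀ k → bit F k ≡ true → Σ[ M ∈ ES ] (IsPM S M × fC S F M × bit M k ≡ true)
  cover⊆⋃fC = hexagon-edge-induction g g∈S (λ k → bit F k ≡ true → Σ[ M ∈ ES ] (IsPM S M × fC S F M × bit M k ≡ true))
    on-hexagon off-hexagons
    where
    on-hexagon : ∀ i q → _ → Σ[ M ∈ ES ] (IsPM S M × fC S F M × bit M (indexOf (g∈S i) q) ≡ true)
    on-hexagon i q _ = ψ u , ψ-IsPM u , ψ∈fF u , (begin
      bit (ψ u) (indexOf (g∈S i) q)   ≡⟨ ψ-on u i q ⟩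
      not (odd q) xor lookup u i      ≡⟨ cong (not (odd q) xor_) (lookup-replicate i (odd q)) ⟩
      not (odd q) xor odd q           ≡⟨ Bool.xor-inverseˡ (odd q) ⟩
      true                            ∎)
      where
      open ≡-Reasoning
      u = replicate n (odd q)
    off-hexagons : ∀ k → (∀ i → inCell k (g i) ≡ false) → bit F k ≡ true → Σ[ M ∈ ES ] (IsPM S M × fC S F M × bit M k ≡ true)
    off-hexagons k off k∈F = ψ u₀ , ψ-IsPM u₀ , ψ∈fF u₀ , trans (ψ-off u₀ k off) k∈F
      where u₀ = replicate n false

  fC⊆⇒cover⊆ : ∀ F′ → ClarCover S F′ → (∀ M → IsPM S M → fC S F M → fC S F′ M) →
    ∀ k → bit F k ≡ true → bit F′ k ≡ true
  fC⊆⇒cover⊆ F′ cover′ fF⊆fF′ k k∈F = via (cover⊆⋃fC k k∈F)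
    where
    via : Σ[ M ∈ ES ] (IsPM S M × fC S F M × bit M k ≡ true) → bit F′ k ≡ true
    via (M , pm , M∈fF , k∈M) = fC⊆cover {F′} {M} cover′ pm (fF⊆fF′ M pm M∈fF) k k∈M


module CubeToCover (S : List Cell) (n : ℕ) (W : ESet S → Set) (cube : InducesCube S n W) where

  open Geometry
  open Edges S
  open Resonance S
  open Alternation S
  open ClarCovers S
  open Toggle S
  open XorSums
  open Cube

  φ : Vec Bool n → ES
  φ = proj₁ cube

  φ-IsPM : ∀ u → IsPM S (φ u)
  φ-IsPM u = proj₁ (proj₁ (proj₂ cube) u)

  φ-injective : ∀ u v → φ u ≡ φ v → u ≡ v
  φ-injective = proj₁ (proj₂ (proj₂ cube))

  φ-surjective : ∀ M → IsPM S M → W M → Σ[ u ∈ Vec Bool n ] φ u ≡ M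
  φ-surjective = proj₁ (proj₂ (proj₂ (proj₂ cube)))

  φ-RAdj⇔QAdj : ∀ u v → RAdj S (φ u) (φ v) ⇔ QAdj S u v
  φ-RAdj⇔QAdj = proj₂ (proj₂ (proj₂ (proj₂ cube)))

  flipAlong : ∀ u i → Σ[ h ∈ Cell ] HexFlip (φ u) (φ (flip u i)) h
  flipAlong u i = RAdj⇒HexFlip (Equivalence.from (φ-RAdj⇔QAdj u (flip u i)) (flip-QAdj u i))

  hexagonAlong : Vec Bool n → Fin n → Cell
  hexagonAlong u i = proj₁ (flipAlong u i)

  hexFlipAlong : ∀ u i → HexFlip (φ u) (φ (flip u i)) (hexagonAlong u i)
  hexFlipAlong u i = proj₂ (flipAlong u i)

  HexFlip-φ-deterministic : ∀ a b c {h} → HexFlip (φ a) (φ b) h → HexFlip (φ a) (φ c) h → b ≡ c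
  HexFlip-φ-deterministic a b c fl fl′ = φ-injective b c (HexFlip-deterministic {φ a} fl fl′)

  hexagonAlong-back : ∀ u i → hexagonAlong (flip u i) i ≡ hexagonAlong u i
  hexagonAlong-back u i = HexFlip-hexagon-unique (HexFlip-sym (hexFlipAlong u i))
    (subst (λ v → HexFlip (φ (flip u i)) (φ v) (hexagonAlong (flip u i) i)) (flip-involutive u i) (hexFlipAlong (flip u i) i))

  hexagonAlong-square : ∀ u i j → i ≢ j → hexagonAlong (flip u j) i ≡ hexagonAlong u i
  hexagonAlong-square u i j i≢j = hexagon-square (HexFlip.hexagon∈S A-flip) (HexFlip.hexagon∈S D-flip) B C square A≢C D≢C
    where
    A = hexagonAlong u i
    B = hexagonAlong (flip u i) j
    C = hexagonAlong u j
    D = hexagonAlong (flip u j) i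
    A-flip = hexFlipAlong u i
    B-flip = hexFlipAlong (flip u i) j
    C-flip = hexFlipAlong u j
    D-flip = hexFlipAlong (flip u j) i
    square : ∀ k → inCell k A xor inCell k B ≡ inCell k C xor inCell k D
    square k = xor-cancelˡ m _ _ (begin
      m xor (inCell k A xor inCell k B)     ≡⟨ sym (Bool.xor-assoc m _ _) ⟩
      (m xor inCell k A) xor inCell k B     ≡⟨ cong (_xor inCell k B) (sym (HexFlip-target A-flip k)) ⟩
      bit (φ (flip u i)) k xor inCell k B   ≡⟨ sym (HexFlip-target B-flip k) ⟩
      bit (φ (flip (flip u i) j)) k         ≡⟨ cong (λ v → bit (φ v) k) (flip-comm u i j i≢j) ⟩
      bit (φ (flip (flip u j) i)) k         ≡⟨ HexFlip-target D-flip k ⟩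
      bit (φ (flip u j)) k xor inCell k D   ≡⟨ cong (_xor inCell k D) (HexFlip-target C-flip k) ⟩
      (m xor inCell k C) xor inCell k D     ≡⟨ Bool.xor-assoc m _ _ ⟩
      m xor (inCell k C xor inCell k D)     ∎)
      where
      open ≡-Reasoning
      m = bit (φ u) k
    A≢C : A ≢ C
    A≢C A≡C = lookup-flip-≢ u i (begin
      lookup (flip u i) i          ≡⟨ cong (λ v → lookup v i) (HexFlip-φ-deterministic u (flip u i) (flip u j) A-flip
                                        (subst (HexFlip (φ u) (φ (flip u j))) (sym A≡C) C-flip)) ⟩
      lookup (flip u j) i          ≡⟨ lookup-flip′ u j i i≢j ⟩
      lookup u i                   ∎)
      where open ≡-Reasoning
    D≢C : D ≢ C
    D≢C D≡C = lookup-flip-≢ (flip u j) i (begin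
      lookup (flip (flip u j) i) i ≡⟨ cong (λ v → lookup v i) (HexFlip-φ-deterministic (flip u j) (flip (flip u j) i) u D-flip
                                        (subst (HexFlip (φ (flip u j)) (φ u)) (sym D≡C) (HexFlip-sym C-flip))) ⟩
      lookup u i                   ≡⟨ sym (lookup-flip′ u j i i≢j) ⟩
      lookup (flip u j) i          ∎)
      where open ≡-Reasoning

  u₀ : Vec Bool n
  u₀ = replicate n false

  M₀ : ES
  M₀ = φ u₀

  h : Fin n → Cell
  h = hexagonAlong u₀

  hexagonAlong-constant : ∀ u i → hexagonAlong u i ≡ h i
  hexagonAlong-constant = cube-induction (λ u → ∀ i → hexagonAlong u i ≡ h i) (λ _ → refl) flip-step
    where
    flip-step : ∀ u j → lookup u j ≡ false → (∀ i → hexagonAlong u i ≡ h i) → ∀ i → hexagonAlong (flip u j) i ≡ h i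
    flip-step u j _ constant i with i Fin.≟ j
    ... | yes refl = trans (hexagonAlong-back u i) (constant i)
    ... | no i≢j = trans (hexagonAlong-square u i j i≢j) (constant i)

  flip-h : ∀ u i → HexFlip (φ u) (φ (flip u i)) (h i)
  flip-h u i = subst (HexFlip (φ u) (φ (flip u i))) (hexagonAlong-constant u i) (hexFlipAlong u i)

  h∈S : ∀ i → h i ∈ S
  h∈S i = HexFlip.hexagon∈S (hexFlipAlong u₀ i)

  h-AlternatesAt : ∀ u i r → AlternatesAt (φ u) (h∈S i) r
  h-AlternatesAt u i r = AlternatesAt-irrelevant {φ u} _ (h∈S i) r (HexFlip⇒AlternatesAt (φ-IsPM u) (φ-IsPM (flip u i)) (flip-h u i) r)

  h-AlternatingBits : ∀ u i → AlternatingBits (φ u) (h∈S i)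
  h-AlternatingBits u i = AlternatesAt⇒AlternatingBits {φ u} (h∈S i) (h-AlternatesAt u i)

  h-injective : ∀ i j → h i ≡ h j → i ≡ j
  h-injective i j hᵢ≡hⱼ with i Fin.≟ j
  ... | yes i≡j = i≡j
  ... | no i≢j = ⊥-elim (lookup-flip-≢ u₀ i (begin
    lookup (flip u₀ i) i   ≡⟨ cong (λ v → lookup v i) (HexFlip-φ-deterministic u₀ (flip u₀ i) (flip u₀ j) (flip-h u₀ i)
                                (subst (HexFlip M₀ (φ (flip u₀ j))) (sym hᵢ≡hⱼ) (flip-h u₀ j))) ⟩
    lookup (flip u₀ j) i   ≡⟨ lookup-flip′ u₀ j i i≢j ⟩
    lookup u₀ i            ∎))
    where open ≡-Reasoning

  h-vertexDisjoint : ∀ i j → j ≢ i → ∀ r r′ → vertexAt (h i) r ≢ vertexAt (h j) r′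
  h-vertexDisjoint i j j≢i = flip-preserves-alternation⇒vertex-disjoint {M₀} (φ-IsPM u₀) (h∈S i) (h∈S j)
    (h-AlternatesAt u₀ i) (h-AlternatesAt u₀ j) (flip-h u₀ i) (h-AlternatesAt (flip u₀ i) j) (j≢i ∘ h-injective j i)

  h-disjoint : EdgeDisjoint h
  h-disjoint = vertexDisjoint⇒EdgeDisjoint h h-vertexDisjoint

  φ≡toggle : ∀ u → φ u ≡ toggle M₀ h u
  φ≡toggle = cube-induction (λ u → φ u ≡ toggle M₀ h u) base flip-step
    where
    base : M₀ ≡ toggle M₀ h u₀
    base = Pointwise-≡⇒≡ (ext λ k → sym (toggle-off-zero k))
      where
      toggle-off-zero : ∀ k → bit (toggle M₀ h u₀) k ≡ bit M₀ k
      toggle-off-zero k = trans (bit-toggle M₀ h u₀ k) (trans (cong (bit M₀ k xor_)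
        (sum-false _ (λ i → cong (_∧ inCell k (h i)) (lookup-replicate i false)))) (Bool.xor-identityʳ _))
    flip-step : ∀ u i → lookup u i ≡ false → φ u ≡ toggle M₀ h u → φ (flip u i) ≡ toggle M₀ h (flip u i)
    flip-step u i _ φu≡ = HexFlip-deterministic {φ u} (flip-h u i)
      (subst (λ M → HexFlip M (toggle M₀ h (flip u i)) (h i)) (sym φu≡) (toggle-flip M₀ h u i (h∈S i)))

  same-vertex⇒same-hexagon : ∀ i j r r′ → vertexAt (h i) r ≡ vertexAt (h j) r′ → i ≡ j
  same-vertex⇒same-hexagon i j r r′ same with i Fin.≟ j
  ... | yes i≡j = i≡j
  ... | no i≢j = ⊥-elim (h-vertexDisjoint i j (i≢j ∘ sym) r r′ same)

  onHexagon : Fin (nE S) → Bool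
  onHexagon k = does (Fin.any? λ i → inCell k (h i) Bool.≟ true)

  F : ES
  F = tabulate λ k → bit M₀ k ∨ onHexagon k

  F-hexagon : ∀ k i → inCell k (h i) ≡ true → bit F k ≡ true
  F-hexagon k i k∈hᵢ = trans (lookup∘tabulate _ k)
    (trans (cong (bit M₀ k ∨_) (dec-true (Fin.any? λ i → inCell k (h i) Bool.≟ true) (i , k∈hᵢ))) (Bool.∨-zeroʳ _))

  F-M₀ : ∀ k → bit M₀ k ≡ true → bit F k ≡ true
  F-M₀ k k∈M₀ = trans (lookup∘tabulate _ k) (cong (_∨ onHexagon k) k∈M₀)

  F-off : ∀ k → (∀ i → inCell k (h i) ≡ false) → bit F k ≡ bit M₀ k
  F-off k off = trans (lookup∘tabulate _ k) (trans (cong (bit M₀ k ∨_)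
    (dec-false (Fin.any? λ i → inCell k (h i) Bool.≟ true) (λ (i , k∈hᵢ) → Bool.not-¬ k∈hᵢ (off i)))) (Bool.∨-identityʳ _))

  F-edge : ∀ k → bit F k ≡ true → (Σ[ i ∈ Fin n ] inCell k (h i) ≡ true) ⊎ bit M₀ k ≡ true
  F-edge k k∈F = by-case (bit M₀ k) refl
    where
    by-case : ∀ b → bit M₀ k ≡ b → (Σ[ i ∈ Fin n ] inCell k (h i) ≡ true) ⊎ bit M₀ k ≡ true
    by-case true k∈M₀ = inj₂ k∈M₀
    by-case false k∉M₀ = inj₁ (does-true⁻ (Fin.any? λ i → inCell k (h i) Bool.≟ true)
      (trans (sym (cong (_∨ onHexagon k) k∉M₀)) (trans (sym (lookup∘tabulate _ k)) k∈F)))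

  F-closed : ∀ i k r → bit F k ≡ true → Incident (vertexAt (h i) r) (edgeOf k) → inCell k (h i) ≡ true
  F-closed i k r k∈F inc = via (F-edge k k∈F)
    where
    via : (Σ[ j ∈ Fin n ] inCell k (h j) ≡ true) ⊎ bit M₀ k ≡ true → inCell k (h i) ≡ true
    via (inj₂ k∈M₀) = matchedEdge∈hexagon {M₀} (h∈S i) (φ-IsPM u₀) (h-AlternatingBits u₀ i) r k k∈M₀ inc
    via (inj₁ (j , k∈hⱼ)) = subst (λ l → inCell k (h l) ≡ true) (same-vertex⇒same-hexagon j i (proj₁ vertex) r (proj₂ vertex)) k∈hⱼ
      where
      position = inCell⇒edgeAt k (h j) k∈hⱼ
      vertex = incident⇒vertexAt (h j) (proj₁ position) (subst (Incident (vertexAt (h i) r)) (sym (proj₂ position)) inc)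

  h-HexComp : ∀ i → HexComp S F (h i)
  h-HexComp i = h∈S i , edges∈F , closed
    where
    edges∈F : ∀ e → e ∈ cellEdges (h i) → _∈E_ S e F
    edges∈F e e∈hᵢ = indexOf (h∈S i) p , trans (edgeOf-indexOf (h∈S i) p) p≡e , F-hexagon _ i (inCell-indexOf (h∈S i) p)
      where
      p = proj₁ (∈⇒edgeAt (h i) e∈hᵢ)
      p≡e = proj₂ (∈⇒edgeAt (h i) e∈hᵢ)
    closed : ∀ e → _∈E_ S e F → ∀ v → v ∈ cellVertices (h i) → Incident v e → e ∈ cellEdges (h i)
    closed e (k , refl , k∈F) v v∈hᵢ inc = inCell-true⁻ k (h i)
      (F-closed i k r k∈F (subst (λ w → Incident w (edgeOf k)) (sym r≡v) inc))
      where
      r = proj₁ (∈⇒vertexAt (h i) v∈hᵢ)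
      r≡v = proj₂ (∈⇒vertexAt (h i) v∈hᵢ)

  -- A hexagon component c of F has an edge on some h i: its two edges at the corner p₀
  -- cannot both be edges of the perfect matching M₀.
  HexComp⇒h : ∀ {c} → HexComp S F c → Σ[ i ∈ Fin n ] h i ≡ c
  HexComp⇒h {c} (c∈S , edges∈F , _) = at-p₀ (F-edge _ (edge∈F p₀))
    where
    edge∈F : ∀ p → bit F (indexOf c∈S p) ≡ true
    edge∈F p = ∈E⇒bit F _ (edgeOf-indexOf c∈S p) (edges∈F _ (edgeAt∈ c p))
    on-h : ∀ p i → inCell (indexOf c∈S p) (h i) ≡ true → h i ≡ c
    on-h p i on = inCell-twice⇒≡ c∈S (h i) p (prev p) (λ e → prev≢ p (sym e)) on
      (F-closed i _ (proj₁ vertex) (edge∈F (prev p))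
        (subst (λ w → Incident w _) (sym (proj₂ vertex)) (incident-indexOf c∈S p (prev p) (inj₂ refl))))
      where
      position = inCell⇒edgeAt _ (h i) on
      vertex : Σ[ r ∈ Pos ] vertexAt (h i) r ≡ vertexAt c p
      vertex = incident⇒vertexAt (h i) (proj₁ position)
        (subst (Incident (vertexAt c p)) (sym (trans (proj₂ position) (edgeOf-indexOf c∈S p))) (edgeAt-incidentʳ c p))
    at-p₅ : bit M₀ (indexOf c∈S p₀) ≡ true → (Σ[ i ∈ Fin n ] inCell (indexOf c∈S p₅) (h i) ≡ true) ⊎ bit M₀ (indexOf c∈S p₅) ≡ true →
      Σ[ i ∈ Fin n ] h i ≡ c
    at-p₅ _ (inj₁ (i , on)) = i , on-h p₅ i on
    at-p₅ p₀∈M₀ (inj₂ p₅∈M₀) = ⊥-elim (IsPM⇒¬bothAt {M₀} c∈S (φ-IsPM u₀) p₀ p₀∈M₀ p₅∈M₀)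
    at-p₀ : (Σ[ i ∈ Fin n ] inCell (indexOf c∈S p₀) (h i) ≡ true) ⊎ bit M₀ (indexOf c∈S p₀) ≡ true → Σ[ i ∈ Fin n ] h i ≡ c
    at-p₀ (inj₁ (i , on)) = i , on-h p₀ i on
    at-p₀ (inj₂ p₀∈M₀) = at-p₅ p₀∈M₀ (F-edge _ (edge∈F p₅))

  -- A vertex off all hexagons h i is covered by its M₀-edge, which is then a component of F:
  -- an F-edge on some h i at one of its endpoints would force that M₀-edge onto h i.
  F-ClarCover : ClarCover S F
  F-ClarCover v v∈ = by-case (Fin.any? λ i → Fin.any? λ r → vertexAt (h i) r ≟V v)
    where
    by-case : Dec (Σ[ i ∈ Fin n ] Σ[ r ∈ Pos ] vertexAt (h i) r ≡ v) → ComponentAt F v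
    by-case (yes (i , r , r≡v)) = inj₁ (h i , h-HexComp i , subst (_∈ cellVertices (h i)) r≡v (vertexAt∈ (h i) r))
    by-case (no off) = inj₂ (e₀ , ((k₀ , k₀≡e₀ , F-M₀ k₀ k₀∈M₀) , isolated) , inc₀)
      where
      matched = φ-IsPM u₀ v v∈
      e₀ = proj₁ matched
      e₀∈M₀ = proj₁ (proj₂ matched)
      inc₀ = proj₁ (proj₂ (proj₂ matched))
      k₀ = proj₁ e₀∈M₀
      k₀≡e₀ = proj₁ (proj₂ e₀∈M₀)
      k₀∈M₀ = proj₂ (proj₂ e₀∈M₀)
      at : ∀ {w} → Incident w e₀ → ∀ e′ → _∈E_ S e′ F → Incident w e′ → e′ ≡ e₀
      at {w} w∈e₀ e′ (k , refl , k∈F) inc = via (F-edge k k∈F)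
        where
        w∈e₀′ : Incident w (edgeOf k₀)
        w∈e₀′ = subst (Incident w) (sym k₀≡e₀) w∈e₀
        via : (Σ[ i ∈ Fin n ] inCell k (h i) ≡ true) ⊎ bit M₀ k ≡ true → edgeOf k ≡ e₀
        via (inj₂ k∈M₀) = IsPM-unique {M₀} (φ-IsPM u₀) (incident⇒∈VH k inc) (bit⇒∈E M₀ k k∈M₀) inc e₀∈M₀ w∈e₀
        via (inj₁ (i , k∈hᵢ)) = ⊥-elim (off (i , proj₁ v-on-hᵢ , proj₂ v-on-hᵢ))
          where
          position = inCell⇒edgeAt k (h i) k∈hᵢ
          w-on-hᵢ = incident⇒vertexAt (h i) (proj₁ position) (subst (Incident w) (sym (proj₂ position)) inc)
          k₀∈hᵢ = matchedEdge∈hexagon {M₀} (h∈S i) (φ-IsPM u₀) (h-AlternatingBits u₀ i) (proj₁ w-on-hᵢ) k₀ k₀∈M₀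
            (subst (λ x → Incident x (edgeOf k₀)) (sym (proj₂ w-on-hᵢ)) w∈e₀′)
          position₀ = inCell⇒edgeAt k₀ (h i) k₀∈hᵢ
          v-on-hᵢ = incident⇒vertexAt (h i) (proj₁ position₀) (subst (Incident v) (sym (trans (proj₂ position₀) k₀≡e₀)) inc₀)
      isolated : ∀ e′ → _∈E_ S e′ F → Incident (proj₁ e₀) e′ ⊎ Incident (proj₂ e₀) e′ → e′ ≡ e₀
      isolated e′ e′∈F (inj₁ inc) = at (inj₁ refl) e′ e′∈F inc
      isolated e′ e′∈F (inj₂ inc) = at (inj₂ refl) e′ e′∈F inc

  F-NumHex : NumHex S F n
  F-NumHex = List.tabulate h , tabulate⁺ (h-injective _ _) , (λ c → mk⇔ (to c) (from c)) , length-tabulate h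
    where
    to : ∀ c → c ∈ List.tabulate h → HexComp S F c
    to c c∈ = subst (HexComp S F) (sym (proj₂ (∈-tabulate⁻ c∈))) (h-HexComp (proj₁ (∈-tabulate⁻ c∈)))
    from : ∀ c → HexComp S F c → c ∈ List.tabulate h
    from c hc = subst (_∈ List.tabulate h) (proj₂ (HexComp⇒h hc)) (∈-tabulate⁺ (proj₁ (HexComp⇒h hc)))

  φ∈fF : ∀ u → fC S F (φ u)
  φ∈fF u = hexagons , single-edges
    where
    hexagons : ∀ c → HexComp S F c → Alternating S (φ u) c
    hexagons c hc = subst (Alternating S (φ u)) (proj₂ (HexComp⇒h hc))
      (AlternatingBits⇒Alternating {φ u} (h∈S _) (h-AlternatingBits u (proj₁ (HexComp⇒h hc))))
    single-edges : ∀ e → EdgeComp S F e → _∈E_ S e (φ u)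
    single-edges e ec@((k , refl , k∈F) , _) = k , refl , (begin
      bit (φ u) k               ≡⟨ cong (λ M → bit M k) (φ≡toggle u) ⟩
      bit (toggle M₀ h u) k     ≡⟨ toggle-off M₀ h u k off ⟩
      bit M₀ k                  ≡⟨ sym (F-off k off) ⟩
      bit F k                   ≡⟨ k∈F ⟩
      true                      ∎)
      where
      open ≡-Reasoning
      off : ∀ i → inCell k (h i) ≡ false
      off i = inCell-false⁺ k (h i) (EdgeComp∉cellEdges {F} ec (h-HexComp i))

  F-SameInduced : SameInduced S (fC S F) W
  F-SameInduced M pm = mk⇔ to from
    where
    from : W M → fC S F M
    from M∈W = subst (fC S F) (proj₂ (φ-surjective M pm M∈W)) (φ∈fF (proj₁ (φ-surjective M pm M∈W)))
    to : fC S F M → W M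
    to M∈fF = subst W (fC-determined {F} F-ClarCover (List.tabulate h) (λ c → proj₁ (proj₂ (proj₂ F-NumHex)) c)
        (φ-IsPM u) (φ∈fF u) pm M∈fF same-p₀) (proj₂ (proj₁ (proj₂ cube) u))
      where
      u = tabulate (λ i → bit M₀ (indexOf (h∈S i) p₀) xor bit M (indexOf (h∈S i) p₀))
      same-at : ∀ i → bit (φ u) (indexOf (h∈S i) p₀) ≡ bit M (indexOf (h∈S i) p₀)
      same-at i = begin
        bit (φ u) k                             ≡⟨ cong (λ M′ → bit M′ k) (φ≡toggle u) ⟩
        bit (toggle M₀ h u) k                   ≡⟨ toggle-on M₀ h h-disjoint u k i (inCell-indexOf (h∈S i) p₀) ⟩
        bit M₀ k xor lookup u i                 ≡⟨ cong (bit M₀ k xor_) (lookup∘tabulate _ i) ⟩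
        bit M₀ k xor (bit M₀ k xor bit M k)     ≡⟨ sym (xor-solve (bit M₀ k) (bit M k) _ refl) ⟩
        bit M k                                 ∎
        where
        open ≡-Reasoning
        k = indexOf (h∈S i) p₀
      same-p₀ : ∀ {c} (hc : HexComp S F c) → bit (φ u) (indexOf (proj₁ hc) p₀) ≡ bit M (indexOf (proj₁ hc) p₀)
      same-p₀ hc = subst (λ k → bit (φ u) k ≡ bit M k) (indexOf-cong (h∈S i) (proj₁ hc) hᵢ≡c p₀) (same-at i)
        where
        i = proj₁ (HexComp⇒h hc)
        hᵢ≡c = proj₂ (HexComp⇒h hc)

corollary1 : (S : List Cell) → HexagonalSystem S → Kekulean S → (n : ℕ) →
    ((F : ESet S) → ClarCover S F → NumHex S F n → InducesCube S n (fC S F))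
  × ((F F' : ESet S) → ClarCover S F → NumHex S F n → ClarCover S F' → NumHex S F' n →
       SameInduced S (fC S F) (fC S F') → F ≡ F')
  × ((W : ESet S → Set) → InducesCube S n W →
       Σ[ F ∈ ESet S ] (ClarCover S F × NumHex S F n × SameInduced S (fC S F) W))
corollary1 S _ _ n = f-cube , f-injective , f-surjective
  where
  f-cube : (F : ESet S) → ClarCover S F → NumHex S F n → InducesCube S n (fC S F)
  f-cube F cover (L , L-unique , L-hexagons , |L|≡n) =
    subst (λ m → InducesCube S m (fC S F)) |L|≡n (CoverToCube.ψ-cube S F cover L L-unique L-hexagons)
  f-injective : (F F′ : ESet S) → ClarCover S F → NumHex S F n → ClarCover S F′ → NumHex S F′ n →
    SameInduced S (fC S F) (fC S F′) → F ≡ F′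
  f-injective F F′ cover (L , L-unique , L-hexagons , _) cover′ (L′ , L′-unique , L′-hexagons , _) same =
    Pointwise-≡⇒≡ (ext λ k → Bool.⇔→≡ (mk⇔
      (CoverToCube.fC⊆⇒cover⊆ S F cover L L-unique L-hexagons F′ cover′ (λ M pm → Equivalence.to (same M pm)) k)
      (CoverToCube.fC⊆⇒cover⊆ S F′ cover′ L′ L′-unique L′-hexagons F cover (λ M pm → Equivalence.from (same M pm)) k)))
  f-surjective : (W : ESet S → Set) → InducesCube S n W →
    Σ[ F ∈ ESet S ] (ClarCover S F × NumHex S F n × SameInduced S (fC S F) W)
  f-surjective W cube = F , F-ClarCover , F-NumHex , F-SameInduced
    where open CubeToCover S n W cube
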